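{- Let $f:\mathbb{Z}_2 \to \mathbb{Z}_2$ be a 1-Lipschitz function with Mahler coefficients $(a_n)_{n\ge 0}$. Then $f$ is uniformly differentiable modulo $2$ with $N_1(f) = 1$ if and only if for every integer $s \geq 2$ and every integer $n$ with $2^s \leq n < 2^{s+1}$ one has $a_n \equiv 0 \pmod{2^{s+1}}$.
   Context: A function $f:\mathbb{Z}_p\to\mathbb{Z}_p$ is 1-Lipschitz if $|f(x)-f(y)|_p \le |x-y|_p$ for all $x,y\in\mathbb{Z}_p$. The Mahler coefficients of a continuous $f$ are $a_n = \sum_{i=0}^{n}(-1)^{n-i}\binom{n}{i} f(i)$, so that $f(x)=\sum_{n\ge0} a_n\binom{x}{n}$. A function $f:\mathbb{Z}_p\to\mathbb{Z}_p$ is uniformly differentiable modulo $p^k$ if there exist a positive integer $N$ and, for each $u\in\mathbb{Z}_p$, an element $\partial_k f(u)\in\mathbb{Q}_p$ (independent of $s$ and $h$) such that for every integer $s\ge N$, every $u\in\mathbb{Z}_p$ and every $h\in\mathbb{Z}_p$, $f(u+p^s h)\equiv f(u)+p^s h\,\partial_k f(u) \pmod{p^{k+s}}$; the smallest such $N$ is denoted $N_k(f)$. Here $p=2$, $k=1$. -}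

module Defs where

open import Data.Nat using (ℕ; zero; suc; _+_; _*_; _∸_; _^_; _≤_; _<_; _%_; _/_)
open import Data.Nat.Properties using (m^n≢0)
open import Data.Nat.Combinatorics using (_C_)
open import Data.Bool using (Bool; true; false; if_then_else_)
open import Data.Nat using (_≤ᵇ_; _≡ᵇ_)
open import Data.List using (List; foldr; map; upTo)
open import Data.Product using (Σ; _×_; _,_)
open import Relation.Binary.PropositionalEquality using (_≡_)

mod2^ : ℕ → ℕ → ℕ
mod2^ k x = _%_ x (2 ^ k) {{m^n≢0 2 k}}

-- 2-adic integers as streams of binary digits: x = Σ_i [x i] 2^i
ℤ₂ : Set
ℤ₂ = ℕ → Bool

res : ℤ₂ → ℕ → ℕ
res x zero = 0
res x (suc k) = res x k + (if x k then 2 ^ k else 0)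

-- the 2-adic integer determined by a compatible family of residues r k (mod 2^k):
-- digit i is bit i of r (i+1)
fromRes : (ℕ → ℕ) → ℤ₂
fromRes r i = 2 ^ i ≤ᵇ mod2^ (suc i) (r (suc i))

ℕ→ℤ₂ : ℕ → ℤ₂
ℕ→ℤ₂ n = fromRes (λ k → n)

0ℤ₂ : ℤ₂
0ℤ₂ = ℕ→ℤ₂ 0

_+₂_ : ℤ₂ → ℤ₂ → ℤ₂
x +₂ y = fromRes (λ k → res x k + res y k)

_*₂_ : ℤ₂ → ℤ₂ → ℤ₂
x *₂ y = fromRes (λ k → res x k * res y k)

-₂_ : ℤ₂ → ℤ₂
-₂ x = fromRes (λ k → 2 ^ k ∸ res x k)

pow2 : ℕ → ℤ₂
pow2 s = ℕ→ℤ₂ (2 ^ s)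

_≡[mod2^_]_ : ℤ₂ → ℕ → ℤ₂ → Set
x ≡[mod2^ m ] y = res x m ≡ res y m

-- 1-Lipschitz: |f x - f y|₂ ≤ |x - y|₂, i.e. x ≡ y mod 2^m ⇒ f x ≡ f y mod 2^m
OneLipschitz : (ℤ₂ → ℤ₂) → Set
OneLipschitz f = ∀ x y m → x ≡[mod2^ m ] y → f x ≡[mod2^ m ] f y

mahlerTerm : (ℤ₂ → ℤ₂) → ℕ → ℕ → ℤ₂
mahlerTerm f n i =
  let t = ℕ→ℤ₂ (n C i) *₂ f (ℕ→ℤ₂ i)
  in if (n ∸ i) % 2 ≡ᵇ 0 then t else -₂ t

mahler : (ℤ₂ → ℤ₂) → ℕ → ℤ₂
mahler f n = foldr _+₂_ 0ℤ₂ (map (mahlerTerm f n) (upTo (suc n)))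

-- ℚ₂ = ℤ₂[1/2]: a pair (m , d) represents d / 2^m.
ℚ₂ : Set
ℚ₂ = ℕ × ℤ₂

-- For ∂ = d/2^m:  f(u + 2^s h) ≡ f(u) + 2^s h ∂  (mod 2^(k+s))  in ℚ₂
-- (difference lies in 2^(k+s) ℤ₂), equivalently after multiplying by 2^m:
-- 2^m f(u + 2^s h) ≡ 2^m f(u) + 2^s h d  (mod 2^(k+s+m)) in ℤ₂.
DiffCongr : (ℤ₂ → ℤ₂) → ℕ → ℕ → ℤ₂ → ℤ₂ → ℚ₂ → Set
DiffCongr f k s u h (m , d) =
  (pow2 m *₂ f (u +₂ (pow2 s *₂ h)))
    ≡[mod2^ (k + s + m) ]
  ((pow2 m *₂ f u) +₂ (pow2 s *₂ (h *₂ d)))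

UnifDiffWith : ℕ → ℕ → (ℤ₂ → ℤ₂) → Set
UnifDiffWith k N f =
  Σ (ℤ₂ → ℚ₂) λ ∂ → ∀ s → N ≤ s → ∀ u h → DiffCongr f k s u h (∂ u)

HasNk : ℕ → (ℤ₂ → ℤ₂) → ℕ → Set
HasNk k f N =
  (1 ≤ N) × UnifDiffWith k N f × (∀ M → 1 ≤ M → UnifDiffWith k M f → N ≤ M)

module Submission where

-- Write g_K(x) = f(x) mod 2^K for x ∈ ℕ. As f is 1-Lipschitz these residue sequences determine
-- f, and aₙ mod 2^K is the forward difference Δⁿ g_K(0). Split Δ^(2^r) = I_r + D_r, where
-- D_r g(x) = g(x + 2^r) − g(x) and I_r collects the terms C(2^r, j) with 0 < j < 2^r. Since
-- v₂(C(2^r, j)) ≥ r − v₂(j), the Lipschitz property gives I_r g ≡ 0 mod 2^r,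
-- I_r (D_r g) ≡ 0 mod 2^(r+1) and I_r (I_r g) ≡ 0 mod 2^(r+2); as I_r and D_r commute,
--   Δ^(2^(r+1)) g = (I_r + D_r)² g ≡ D_r (D_r g)  (mod 2^(r+2)).
-- So the Mahler condition for n ∈ [2^s, 2^(s+1)) says exactly that
--   f(x + 2^s) − f(x) ≡ 2 (f(x + 2^(s−1)) − f(x))  (mod 2^(s+1))  for x ∈ ℕ.
-- Iterating this doubling relation yields f(u + 2^s h) ≡ f(u) + 2^(s−1) h (f(u + 2) − f(u))
-- mod 2^(s+1) for all s ≥ 1, i.e. uniform differentiability with ∂f(u) = (f(u + 2) − f(u))/2 and
-- N₁(f) = 1; conversely, comparing the congruences for the steps 2^(s−1) and 2^s gives the
-- doubling relation.

open import Defs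

module BinomialValuation where
  open import Data.Nat using (ℕ; zero; suc; _+_; _*_; _<_; z≤n; s≤s; _^_)
  open import Data.Nat.Properties
    using (+-suc; +-identityʳ; +-comm; *-identityʳ; *-zeroʳ; *-comm; *-assoc; <-irrefl; m<m+n)
  open import Data.Nat.Divisibility
    using (_∣_; divides; _∣0; 1∣_; ∣-trans; m∣m*n; ∣m⇒∣m*n; ∣m+n∣m⇒∣n; *-monoʳ-∣; *-cancelˡ-∣)
  open import Data.Nat.Combinatorics using (_C_; nC1≡n; nCk+nC[k+1]≡[n+1]C[k+1])
  open import Data.Nat.Induction using (<-rec)
  open import Data.Nat.Tactic.RingSolver using (solve-∀)
  open import Data.Product using (Σ; ∃₂; _,_)
  open import Data.Sum using (_⊎_; inj₁; inj₂)
  open import Relation.Nullary using (contradiction)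
  open import Relation.Binary.PropositionalEquality

  even-or-odd : ∀ n → Σ ℕ λ q → n ≡ 2 * q ⊎ n ≡ suc (2 * q)
  even-or-odd zero = 0 , inj₁ refl
  even-or-odd (suc n) with even-or-odd n
  ... | q , inj₁ refl = q , inj₂ refl
  ... | q , inj₂ refl = suc q , inj₁ (sym (+-suc (suc q) (q + 0)))

  2-adic-decomposition : ∀ j → 0 < j → ∃₂ λ a c → j ≡ 2 ^ a * suc (2 * c)
  2-adic-decomposition = <-rec _ step
    where
    step : ∀ j → (∀ {i} → i < j → 0 < i → ∃₂ λ a c → i ≡ 2 ^ a * suc (2 * c)) →
           0 < j → ∃₂ λ a c → j ≡ 2 ^ a * suc (2 * c)
    step j rec 0<j with even-or-odd j
    ... | c     , inj₂ refl = 0 , c , sym (+-identityʳ _)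
    ... | zero  , inj₁ refl = contradiction 0<j (<-irrefl refl)
    ... | suc q , inj₁ refl with rec (m<m+n (suc q) (s≤s z≤n)) (s≤s z≤n)
    ...   | a , c , eq = suc a , c , trans (cong (2 *_) eq) (sym (*-assoc 2 (2 ^ a) _))

  [1+k]*[1+n]C[1+k]≡[1+n]*nCk : ∀ n k → suc k * (suc n C suc k) ≡ suc n * (n C k)
  [1+k]*[1+n]C[1+k]≡[1+n]*nCk n       zero    = trans (+-identityʳ _) (trans (nC1≡n (suc n)) (sym (*-identityʳ (suc n))))
  [1+k]*[1+n]C[1+k]≡[1+n]*nCk zero    (suc k) = *-zeroʳ (suc (suc k))
  [1+k]*[1+n]C[1+k]≡[1+n]*nCk (suc n) (suc k) = begin
    suc (suc k) * (suc (suc n) C suc (suc k))          ≡⟨ cong (suc (suc k) *_) (nCk+nC[k+1]≡[n+1]C[k+1] (suc n) (suc k)) ⟨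
    suc (suc k) * (X + Y)                              ≡⟨ lemma (suc k) X Y ⟩
    suc k * X + X + suc (suc k) * Y
      ≡⟨ cong₂ (λ u v → u + X + v) ([1+k]*[1+n]C[1+k]≡[1+n]*nCk n k) ([1+k]*[1+n]C[1+k]≡[1+n]*nCk n (suc k)) ⟩
    suc n * (n C k) + X + suc n * (n C suc k)          ≡⟨ lemma′ (suc n) (n C k) (n C suc k) X ⟩
    suc n * (n C k + n C suc k) + X                    ≡⟨ cong (λ z → suc n * z + X) (nCk+nC[k+1]≡[n+1]C[k+1] n k) ⟩
    suc n * X + X                                      ≡⟨ +-comm (suc n * X) X ⟩
    suc (suc n) * X                                    ∎
    where
    open ≡-Reasoning
    X = suc n C suc k
    Y = suc n C suc (suc k)
    lemma : ∀ a x y → suc a * (x + y) ≡ a * x + x + suc a * y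
    lemma = solve-∀
    lemma′ : ∀ a p q x → a * p + x + a * q ≡ a * (p + q) + x
    lemma′ = solve-∀

  n∣k*nCk : ∀ n k → n ∣ k * (n C k)
  n∣k*nCk n       zero    = n ∣0
  n∣k*nCk zero    (suc k) = subst (0 ∣_) (sym (*-zeroʳ (suc k))) (0 ∣0)
  n∣k*nCk (suc n) (suc k) = divides (n C k) (trans ([1+k]*[1+n]C[1+k]≡[1+n]*nCk n k) (*-comm (suc n) (n C k)))

  2∣odd*⇒2∣ : ∀ c m → 2 ∣ suc (2 * c) * m → 2 ∣ m
  2∣odd*⇒2∣ c m 2∣odd*m = ∣m+n∣m⇒∣n (subst (2 ∣_) (+-comm m (2 * c * m)) 2∣odd*m) (∣m⇒∣m*n m (m∣m*n c))

  2^r∣odd*m⇒2^r∣m : ∀ r c m → 2 ^ r ∣ suc (2 * c) * m → 2 ^ r ∣ m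
  2^r∣odd*m⇒2^r∣m zero    c m _ = 1∣ m
  2^r∣odd*m⇒2^r∣m (suc r) c m 2^[1+r]∣odd*m with 2∣odd*⇒2∣ c m (∣-trans (m∣m*n (2 ^ r)) 2^[1+r]∣odd*m)
  ... | divides m′ refl = subst (2 ^ suc r ∣_) (*-comm 2 m′)
    (*-monoʳ-∣ 2 (2^r∣odd*m⇒2^r∣m r c m′ (*-cancelˡ-∣ 2 (subst (2 ^ suc r ∣_) (lemma c m′) 2^[1+r]∣odd*m))))
    where lemma : ∀ c m′ → suc (2 * c) * (m′ * 2) ≡ 2 * (suc (2 * c) * m′)
          lemma = solve-∀

  -- v₂(C(2^r, j)) ≥ r − v₂(j), stated without truncated subtraction.
  2^r∣2^a*2^rC[2^a*odd] : ∀ r a c → 2 ^ r ∣ 2 ^ a * (2 ^ r C (2 ^ a * suc (2 * c)))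
  2^r∣2^a*2^rC[2^a*odd] r a c =
    2^r∣odd*m⇒2^r∣m r c _ (subst (2 ^ r ∣_) (lemma (2 ^ a) c _) (n∣k*nCk (2 ^ r) (2 ^ a * suc (2 * c))))
    where lemma : ∀ p c x → p * suc (2 * c) * x ≡ suc (2 * c) * (p * x)
          lemma = solve-∀

module Congruence where
  open import Data.Nat as ℕ using (ℕ; _≤_; _^_)
  import Data.Nat.Properties as ℕ
  import Data.Nat.Divisibility as ℕ
  open import Data.Integer using (ℤ; +_; _+_; _-_; _*_; -_; 0ℤ; 1ℤ)
  import Data.Integer.Properties as ℤ
  open import Data.Integer.Divisibility.Signed
    using (_∣_; divides; ∣-trans; ∣m⇒∣-m; ∣m∣n⇒∣m+n; ∣n⇒∣m*n; *-monoʳ-∣; *-cancelˡ-∣; ∣ᵤ⇒∣)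
  open import Data.Integer.Tactic.RingSolver using (solve-∀)
  open import Data.Product using (_,_)
  open import Relation.Binary.Bundles using (Setoid)
  open import Relation.Binary.Structures using (IsEquivalence)
  open import Relation.Binary.PropositionalEquality

  *-distribˡ-- : ∀ c a b → c * (a - b) ≡ c * a - c * b
  *-distribˡ-- = solve-∀

  *-distribʳ-- : ∀ c a b → (a - b) * c ≡ a * c - b * c
  *-distribʳ-- = solve-∀

  pow2ᶻ : ℕ → ℤ
  pow2ᶻ k = + (2 ^ k)

  pow2ᶻ-+ : ∀ j k → pow2ᶻ (j ℕ.+ k) ≡ pow2ᶻ j * pow2ᶻ k
  pow2ᶻ-+ j k = trans (cong +_ (ℕ.^-distribˡ-+-* 2 j k)) (ℤ.pos-* (2 ^ j) (2 ^ k))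

  infix 4 _≈_[mod2^_]
  record _≈_[mod2^_] (a b : ℤ) (k : ℕ) : Set where
    constructor ∣⇒≈
    field ≈⇒∣ : pow2ᶻ k ∣ a - b
  open _≈_[mod2^_] public

  module _ {k : ℕ} where

    ≈-refl : ∀ {a} → a ≈ a [mod2^ k ]
    ≈-refl {a} = ∣⇒≈ (divides 0ℤ (ℤ.+-inverseʳ a))

    ≈-reflexive : ∀ {a b} → a ≡ b → a ≈ b [mod2^ k ]
    ≈-reflexive refl = ≈-refl

    ≈-sym : ∀ {a b} → a ≈ b [mod2^ k ] → b ≈ a [mod2^ k ]
    ≈-sym {a} {b} (∣⇒≈ a≈b) = ∣⇒≈ (subst (pow2ᶻ k ∣_) (lemma a b) (∣m⇒∣-m a≈b))
      where lemma : ∀ a b → - (a - b) ≡ b - a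
            lemma = solve-∀

    ≈-trans : ∀ {a b c} → a ≈ b [mod2^ k ] → b ≈ c [mod2^ k ] → a ≈ c [mod2^ k ]
    ≈-trans {a} {b} {c} (∣⇒≈ a≈b) (∣⇒≈ b≈c) = ∣⇒≈ (subst (pow2ᶻ k ∣_) (ℤ.+-minus-telescope a b c) (∣m∣n⇒∣m+n a≈b b≈c))

    ≈-isEquivalence : IsEquivalence (_≈_[mod2^ k ])
    ≈-isEquivalence = record { refl = ≈-refl ; sym = ≈-sym ; trans = ≈-trans }

    +-cong : ∀ {a b c d} → a ≈ b [mod2^ k ] → c ≈ d [mod2^ k ] → a + c ≈ b + d [mod2^ k ]
    +-cong {a} {b} {c} {d} (∣⇒≈ a≈b) (∣⇒≈ c≈d) = ∣⇒≈ (subst (pow2ᶻ k ∣_) (lemma a b c d) (∣m∣n⇒∣m+n a≈b c≈d))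
      where lemma : ∀ a b c d → (a - b) + (c - d) ≡ (a + c) - (b + d)
            lemma = solve-∀

    +-congˡ : ∀ a {c d} → c ≈ d [mod2^ k ] → a + c ≈ a + d [mod2^ k ]
    +-congˡ a = +-cong (≈-refl {a})

    -‿cong : ∀ {a b} → a ≈ b [mod2^ k ] → - a ≈ - b [mod2^ k ]
    -‿cong {a} {b} (∣⇒≈ a≈b) = ∣⇒≈ (subst (pow2ᶻ k ∣_) (lemma a b) (∣m⇒∣-m a≈b))
      where lemma : ∀ a b → - (a - b) ≡ - a - - b
            lemma = solve-∀

    sub-cong : ∀ {a b c d} → a ≈ b [mod2^ k ] → c ≈ d [mod2^ k ] → a - c ≈ b - d [mod2^ k ]
    sub-cong a≈b c≈d = +-cong a≈b (-‿cong c≈d)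

    *-congˡ : ∀ {a b} c → a ≈ b [mod2^ k ] → c * a ≈ c * b [mod2^ k ]
    *-congˡ {a} {b} c (∣⇒≈ a≈b) = ∣⇒≈ (subst (pow2ᶻ k ∣_) (*-distribˡ-- c a b) (∣n⇒∣m*n c a≈b))

    *-cong : ∀ {a b c d} → a ≈ b [mod2^ k ] → c ≈ d [mod2^ k ] → a * c ≈ b * d [mod2^ k ]
    *-cong {a} {b} {c} {d} a≈b c≈d = ≈-trans (*-congˡ a c≈d)
      (subst₂ _≈_[mod2^ k ] (ℤ.*-comm d a) (ℤ.*-comm d b) (*-congˡ d a≈b))

  ≈-setoid : ℕ → Setoid _ _
  ≈-setoid k = record { isEquivalence = ≈-isEquivalence {k} }

  module ≈-Reasoning (k : ℕ) where
    open import Relation.Binary.Reasoning.Setoid (≈-setoid k) public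

  pow2ᶻ≈0 : ∀ k → pow2ᶻ k ≈ 0ℤ [mod2^ k ]
  pow2ᶻ≈0 k = ∣⇒≈ (divides 1ℤ (trans (ℤ.+-identityʳ (pow2ᶻ k)) (sym (ℤ.*-identityˡ (pow2ᶻ k)))))

  ≈-weaken : ∀ {j k a b} → j ≤ k → a ≈ b [mod2^ k ] → a ≈ b [mod2^ j ]
  ≈-weaken {j} j≤k (∣⇒≈ k∣a-b) with ℕ.m≤n⇒∃[o]m+o≡n j≤k
  ... | o , refl = ∣⇒≈ (∣-trans (divides (pow2ᶻ o) (trans (pow2ᶻ-+ j o) (ℤ.*-comm (pow2ᶻ j) (pow2ᶻ o)))) k∣a-b)

  ≈-scale : ∀ {j k a b} → a ≈ b [mod2^ k ] → pow2ᶻ j * a ≈ pow2ᶻ j * b [mod2^ j ℕ.+ k ]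
  ≈-scale {j} {k} {a} {b} (∣⇒≈ k∣a-b) = ∣⇒≈ (subst₂ _∣_ (sym (pow2ᶻ-+ j k)) (*-distribˡ-- (pow2ᶻ j) a b)
    (*-monoʳ-∣ (pow2ᶻ j) k∣a-b))

  ≈-unscale : ∀ {j k a b} → pow2ᶻ j * a ≈ pow2ᶻ j * b [mod2^ j ℕ.+ k ] → a ≈ b [mod2^ k ]
  ≈-unscale {j} {k} {a} {b} (∣⇒≈ jk∣ja-jb) = ∣⇒≈ (*-cancelˡ-∣ (pow2ᶻ j) {{ℕ.m^n≢0 2 j}}
    (subst₂ _∣_ (pow2ᶻ-+ j k) (sym (*-distribˡ-- (pow2ᶻ j) a b)) jk∣ja-jb))

  *-≈0 : ∀ {j k a b} → a ≈ 0ℤ [mod2^ j ] → b ≈ 0ℤ [mod2^ k ] → a * b ≈ 0ℤ [mod2^ j ℕ.+ k ]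
  *-≈0 {j} {k} {a} {b} (∣⇒≈ (divides p a-0≡)) (∣⇒≈ (divides q b-0≡)) = ∣⇒≈ (divides (p * q) (begin
    a * b - 0ℤ                     ≡⟨ lemma a b ⟩
    (a - 0ℤ) * (b - 0ℤ)            ≡⟨ cong₂ _*_ a-0≡ b-0≡ ⟩
    p * pow2ᶻ j * (q * pow2ᶻ k)    ≡⟨ lemma′ p q (pow2ᶻ j) (pow2ᶻ k) ⟩
    p * q * (pow2ᶻ j * pow2ᶻ k)    ≡⟨ cong (p * q *_) (pow2ᶻ-+ j k) ⟨
    p * q * pow2ᶻ (j ℕ.+ k)        ∎))
    where
    open ≡-Reasoning
    lemma : ∀ a b → a * b - 0ℤ ≡ (a - 0ℤ) * (b - 0ℤ)
    lemma = solve-∀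
    lemma′ : ∀ p q x y → p * x * (q * y) ≡ p * q * (x * y)
    lemma′ = solve-∀

  module _ {k : ℕ} {a b : ℤ} where

    ≈⇒-≈0 : a ≈ b [mod2^ k ] → a - b ≈ 0ℤ [mod2^ k ]
    ≈⇒-≈0 (∣⇒≈ k∣a-b) = ∣⇒≈ (subst (pow2ᶻ k ∣_) (sym (ℤ.+-identityʳ (a - b))) k∣a-b)

    -≈0⇒≈ : a - b ≈ 0ℤ [mod2^ k ] → a ≈ b [mod2^ k ]
    -≈0⇒≈ (∣⇒≈ k∣a-b-0) = ∣⇒≈ (subst (pow2ᶻ k ∣_) (ℤ.+-identityʳ (a - b)) k∣a-b-0)

  *-≈0-shift : ∀ {a ν r c d} → pow2ᶻ a * c ≈ 0ℤ [mod2^ r ] → d ≈ 0ℤ [mod2^ ν ℕ.+ a ] → c * d ≈ 0ℤ [mod2^ ν ℕ.+ r ]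
  *-≈0-shift {a} {ν} {r} {c} {d} 2^a*c≈0 (∣⇒≈ (divides q d-0≡)) =
    subst (_≈ 0ℤ [mod2^ ν ℕ.+ r ]) (sym c*d≡)
      (subst (pow2ᶻ a * c * (q * pow2ᶻ ν) ≈ 0ℤ [mod2^_]) (ℕ.+-comm r ν) (*-≈0 2^a*c≈0 q2^ν≈0))
    where
    q2^ν≈0 : q * pow2ᶻ ν ≈ 0ℤ [mod2^ ν ]
    q2^ν≈0 = ∣⇒≈ (divides q (ℤ.+-identityʳ (q * pow2ᶻ ν)))
    c*d≡ : c * d ≡ pow2ᶻ a * c * (q * pow2ᶻ ν)
    c*d≡ = begin
      c * d                          ≡⟨ cong (c *_) (trans (sym (ℤ.+-identityʳ d)) d-0≡) ⟩
      c * (q * pow2ᶻ (ν ℕ.+ a))      ≡⟨ cong (λ p → c * (q * p)) (pow2ᶻ-+ ν a) ⟩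
      c * (q * (pow2ᶻ ν * pow2ᶻ a))  ≡⟨ lemma c q (pow2ᶻ ν) (pow2ᶻ a) ⟩
      pow2ᶻ a * c * (q * pow2ᶻ ν)    ∎
      where
      open ≡-Reasoning
      lemma : ∀ c q x y → c * (q * (x * y)) ≡ y * c * (q * x)
      lemma = solve-∀

  ∣⇒+≈0 : ∀ {k n} → 2 ^ k ℕ.∣ n → + n ≈ 0ℤ [mod2^ k ]
  ∣⇒+≈0 {k} {n} 2^k∣n = ∣⇒≈ (subst (pow2ᶻ k ∣_) (sym (ℤ.+-identityʳ (+ n))) (∣ᵤ⇒∣ 2^k∣n))

module Sequences where
  open import Data.Nat as ℕ using (ℕ; zero; suc; _≤_; _<_; z≤n; s≤s; _∸_; _^_; _%_; _/_; _≡ᵇ_; NonZero)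
  import Data.Nat.Properties as ℕ
  import Data.Nat.DivMod as ℕ
  open import Data.Nat.DivMod using (m≡m%n+[m/n]*n; m%n<n)
  open import Data.Nat.Combinatorics using (_C_; k>n⇒nCk≡0; nCk+nC[k+1]≡[n+1]C[k+1]; nCn≡1)
  open import Data.Bool using (true; false; if_then_else_; not)
  open import Data.Integer using (ℤ; +_; _+_; _-_; _*_; -_; 0ℤ; 1ℤ)
  import Data.Integer.Properties as ℤ
  open import Data.Integer.Tactic.RingSolver using (solve-∀)
  open import Data.Product using (_×_; _,_)
  open import Data.Sum using (_⊎_; inj₁; inj₂)
  open import Function using (_∘_)
  open import Relation.Nullary using (yes; no; contradiction)
  open import Relation.Binary.PropositionalEquality
  open Congruence
  open BinomialValuation using (2-adic-decomposition; 2^r∣2^a*2^rC[2^a*odd])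

  Seq : Set
  Seq = ℕ → ℤ

  ∑< : ℕ → Seq → ℤ
  ∑< zero    φ = 0ℤ
  ∑< (suc n) φ = φ 0 + ∑< n (λ i → φ (suc i))

  ∑<-cong : ∀ n {φ ψ} → (∀ i → φ i ≡ ψ i) → ∑< n φ ≡ ∑< n ψ
  ∑<-cong zero    φ≗ψ = refl
  ∑<-cong (suc n) φ≗ψ = cong₂ _+_ (φ≗ψ 0) (∑<-cong n (λ i → φ≗ψ (suc i)))

  ∑<-suc : ∀ n φ → ∑< (suc n) φ ≡ ∑< n φ + φ n
  ∑<-suc zero    φ = ℤ.+-comm (φ 0) 0ℤ
  ∑<-suc (suc n) φ = trans (cong (λ s → φ 0 + s) (∑<-suc n (λ i → φ (suc i)))) (sym (ℤ.+-assoc (φ 0) _ _))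

  ∑<-+ : ∀ n φ ψ → ∑< n (λ i → φ i + ψ i) ≡ ∑< n φ + ∑< n ψ
  ∑<-+ zero    φ ψ = refl
  ∑<-+ (suc n) φ ψ = trans (cong (λ s → φ 0 + ψ 0 + s) (∑<-+ n _ _)) (lemma (φ 0) (ψ 0) _ _)
    where lemma : ∀ a b c d → (a + b) + (c + d) ≡ (a + c) + (b + d)
          lemma = solve-∀

  ∑<-- : ∀ n φ ψ → ∑< n (λ i → φ i - ψ i) ≡ ∑< n φ - ∑< n ψ
  ∑<-- zero    φ ψ = refl
  ∑<-- (suc n) φ ψ = trans (cong (λ s → φ 0 - ψ 0 + s) (∑<-- n _ _)) (lemma (φ 0) (ψ 0) _ _)
    where lemma : ∀ a b c d → (a - b) + (c - d) ≡ (a + c) - (b + d)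
          lemma = solve-∀

  ∑<-≈0 : ∀ {k} n φ → (∀ i → i < n → φ i ≈ 0ℤ [mod2^ k ]) → ∑< n φ ≈ 0ℤ [mod2^ k ]
  ∑<-≈0 zero    φ φ≈0 = ≈-refl
  ∑<-≈0 (suc n) φ φ≈0 = +-cong (φ≈0 0 (s≤s z≤n)) (∑<-≈0 n _ (λ i i<n → φ≈0 (suc i) (s≤s i<n)))

  -- (-1)^m z, with the same parity test as Defs.mahlerTerm
  signed : ℕ → ℤ → ℤ
  signed m z = if m % 2 ≡ᵇ 0 then z else - z

  [2+m]%2≡m%2 : ∀ m → suc (suc m) % 2 ≡ m % 2
  [2+m]%2≡m%2 m = trans (cong (_% 2) (ℕ.+-comm 2 m)) (ℕ.[m+n]%n≡m%n m 2)

  even?-suc : ∀ m → (suc m % 2 ≡ᵇ 0) ≡ not (m % 2 ≡ᵇ 0)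
  even?-suc zero          = refl
  even?-suc (suc zero)    = refl
  even?-suc (suc (suc m)) rewrite [2+m]%2≡m%2 (suc m) | [2+m]%2≡m%2 m = even?-suc m

  signed-suc : ∀ m z → signed (suc m) z ≡ - signed m z
  signed-suc m z rewrite even?-suc m with m % 2 ≡ᵇ 0
  ... | true  = refl
  ... | false = sym (ℤ.neg-involutive z)

  signed-0 : ∀ m → signed m 0ℤ ≡ 0ℤ
  signed-0 m with m % 2 ≡ᵇ 0
  ... | true  = refl
  ... | false = refl

  signed-+ : ∀ m a b → signed m (a + b) ≡ signed m a + signed m b
  signed-+ m a b with m % 2 ≡ᵇ 0
  ... | true  = refl
  ... | false = ℤ.neg-distrib-+ a b

  signed-*ˡ : ∀ m a b → signed m (a * b) ≡ signed m a * b
  signed-*ˡ m a b with m % 2 ≡ᵇ 0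
  ... | true  = refl
  ... | false = ℤ.neg-distribˡ-* a b

  signed-≈0 : ∀ {k} m {z} → z ≈ 0ℤ [mod2^ k ] → signed m z ≈ 0ℤ [mod2^ k ]
  signed-≈0 m z≈0 with m % 2 ≡ᵇ 0
  ... | true  = z≈0
  ... | false = -‿cong z≈0

  Δ : Seq → Seq
  Δ g x = g (suc x) - g x

  Δ^ : ℕ → Seq → Seq
  Δ^ zero    g = g
  Δ^ (suc n) g = Δ (Δ^ n g)

  Δ^-+ : ∀ m n g x → Δ^ (m ℕ.+ n) g x ≡ Δ^ m (Δ^ n g) x
  Δ^-+ zero    n g x = refl
  Δ^-+ (suc m) n g x = cong₂ _-_ (Δ^-+ m n g (suc x)) (Δ^-+ m n g x)

  Δ^-≈0 : ∀ {k} n {g} → (∀ x → g x ≈ 0ℤ [mod2^ k ]) → ∀ x → Δ^ n g x ≈ 0ℤ [mod2^ k ]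
  Δ^-≈0 zero    g≈0 x = g≈0 x
  Δ^-≈0 (suc n) g≈0 x = sub-cong (Δ^-≈0 n g≈0 (suc x)) (Δ^-≈0 n g≈0 x)

  binomialWeight : ℕ → ℕ → ℤ
  binomialWeight n i = signed (n ∸ i) (+ (n C i))

  binomialWeight-zero : ∀ n → binomialWeight (suc n) 0 ≡ - binomialWeight n 0
  binomialWeight-zero n = signed-suc n (+ 1)

  binomialWeight-vanish : ∀ {n i} → n < i → binomialWeight n i ≡ 0ℤ
  binomialWeight-vanish {n} {i} n<i rewrite k>n⇒nCk≡0 n<i = signed-0 (n ∸ i)

  binomialWeight-suc : ∀ n i → binomialWeight (suc n) (suc i) ≡ binomialWeight n i - binomialWeight n (suc i)
  binomialWeight-suc n i = begin
    signed (n ∸ i) (+ (suc n C suc i))                  ≡⟨ cong (signed (n ∸ i) ∘ +_) (nCk+nC[k+1]≡[n+1]C[k+1] n i) ⟨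
    signed (n ∸ i) (+ (n C i) + + (n C suc i))          ≡⟨ signed-+ (n ∸ i) _ _ ⟩
    binomialWeight n i + signed (n ∸ i) (+ (n C suc i)) ≡⟨ cong (λ w → binomialWeight n i + w) next ⟩
    binomialWeight n i - binomialWeight n (suc i)       ∎
    where
    open ≡-Reasoning
    next : signed (n ∸ i) (+ (n C suc i)) ≡ - binomialWeight n (suc i)
    next with i ℕ.<? n
    ... | yes i<n = trans (cong (λ m → signed m (+ (n C suc i))) (ℕ.+-∸-assoc 1 i<n)) (signed-suc (n ∸ suc i) _)
    ... | no  i≮n = begin
      signed (n ∸ i) (+ (n C suc i))  ≡⟨ cong (signed (n ∸ i) ∘ +_) (k>n⇒nCk≡0 n<1+i) ⟩
      signed (n ∸ i) 0ℤ              ≡⟨ signed-0 (n ∸ i) ⟩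
      0ℤ                             ≡⟨ cong -_ (binomialWeight-vanish n<1+i) ⟨
      - binomialWeight n (suc i)     ∎
      where n<1+i = s≤s (ℕ.≮⇒≥ i≮n)

  Δ^-newton : ∀ n g x → Δ^ n g x ≡ ∑< (suc n) (λ i → binomialWeight n i * g (x ℕ.+ i))
  Δ^-newton zero    g x = sym (trans (ℤ.+-identityʳ _) (trans (ℤ.*-identityˡ _) (cong g (ℕ.+-identityʳ x))))
  Δ^-newton (suc n) g x = begin
    Δ^ n g (suc x) - Δ^ n g x                  ≡⟨ cong₂ _-_ (Δ^-newton n g (suc x)) (Δ^-newton n g x) ⟩
    A - (c + B)                                ≡⟨ lemma A B c ⟩
    - c + (A - B)                              ≡⟨ cong₂ (λ u v → u + (A - v)) w₀ B′≡B ⟨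
    w (suc n) 0 * g (x ℕ.+ 0) + (A - B′)        ≡⟨ cong (λ s → w (suc n) 0 * g (x ℕ.+ 0) + s) (∑<-- (suc n) φ ψ) ⟨
    w (suc n) 0 * g (x ℕ.+ 0) + ∑< (suc n) (λ i → w n i * g (suc x ℕ.+ i) - w n (suc i) * g (x ℕ.+ suc i))
                                               ≡⟨ cong (λ s → w (suc n) 0 * g (x ℕ.+ 0) + s) (∑<-cong (suc n) pascal) ⟩
    ∑< (suc (suc n)) (λ i → w (suc n) i * g (x ℕ.+ i)) ∎
    where
    open ≡-Reasoning
    w = binomialWeight
    A = ∑< (suc n) (λ i → w n i * g (suc x ℕ.+ i))
    B = ∑< n (λ i → w n (suc i) * g (x ℕ.+ suc i))
    B′ = ∑< (suc n) (λ i → w n (suc i) * g (x ℕ.+ suc i))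
    φ ψ : Seq
    φ i = w n i * g (suc x ℕ.+ i)
    ψ i = w n (suc i) * g (x ℕ.+ suc i)
    c = w n 0 * g (x ℕ.+ 0)
    lemma : ∀ A B c → A - (c + B) ≡ - c + (A - B)
    lemma = solve-∀
    w₀ : w (suc n) 0 * g (x ℕ.+ 0) ≡ - c
    w₀ = trans (cong (_* g (x ℕ.+ 0)) (binomialWeight-zero n)) (sym (ℤ.neg-distribˡ-* (w n 0) (g (x ℕ.+ 0))))
    B′≡B : B′ ≡ B
    B′≡B = begin
      B′                                   ≡⟨ ∑<-suc n (λ i → w n (suc i) * g (x ℕ.+ suc i)) ⟩
      B + w n (suc n) * g (x ℕ.+ suc n)    ≡⟨ cong (λ v → B + v * g (x ℕ.+ suc n)) (binomialWeight-vanish (ℕ.n<1+n n)) ⟩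
      B + 0ℤ                               ≡⟨ ℤ.+-identityʳ B ⟩
      B                                    ∎
    pascal : ∀ i → w n i * g (suc x ℕ.+ i) - w n (suc i) * g (x ℕ.+ suc i) ≡ w (suc n) (suc i) * g (x ℕ.+ suc i)
    pascal i = begin
      w n i * g (suc x ℕ.+ i) - w n (suc i) * g (x ℕ.+ suc i)
        ≡⟨ cong (λ y → w n i * g y - w n (suc i) * g (x ℕ.+ suc i)) (ℕ.+-suc x i) ⟨
      w n i * g (x ℕ.+ suc i) - w n (suc i) * g (x ℕ.+ suc i)
        ≡⟨ *-distribʳ-- (g (x ℕ.+ suc i)) (w n i) (w n (suc i)) ⟨
      (w n i - w n (suc i)) * g (x ℕ.+ suc i)
        ≡⟨ cong (_* g (x ℕ.+ suc i)) (binomialWeight-suc n i) ⟨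
      w (suc n) (suc i) * g (x ℕ.+ suc i)
        ∎

  Δ2^ : ℕ → Seq → Seq
  Δ2^ s g x = g (x ℕ.+ 2 ^ s) - g x

  Δ2^-twice : ∀ s g x → Δ2^ s g (x ℕ.+ 2 ^ s) - Δ2^ s g x ≡ Δ2^ (suc s) g x - + 2 * Δ2^ s g x
  Δ2^-twice s g x = begin
    (g (x ℕ.+ 2 ^ s ℕ.+ 2 ^ s) - g (x ℕ.+ 2 ^ s)) - (g (x ℕ.+ 2 ^ s) - g x)
      ≡⟨ cong (λ y → (g y - g (x ℕ.+ 2 ^ s)) - (g (x ℕ.+ 2 ^ s) - g x)) (ℕ.+-assoc x (2 ^ s) (2 ^ s)) ⟩
    (g (x ℕ.+ (2 ^ s ℕ.+ 2 ^ s)) - g (x ℕ.+ 2 ^ s)) - (g (x ℕ.+ 2 ^ s) - g x)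
      ≡⟨ cong (λ y → (g (x ℕ.+ y) - g (x ℕ.+ 2 ^ s)) - (g (x ℕ.+ 2 ^ s) - g x)) (cong (2 ^ s ℕ.+_) (ℕ.+-identityʳ (2 ^ s))) ⟨
    (g (x ℕ.+ 2 ^ suc s) - g (x ℕ.+ 2 ^ s)) - (g (x ℕ.+ 2 ^ s) - g x)
      ≡⟨ lemma (g (x ℕ.+ 2 ^ suc s)) (g (x ℕ.+ 2 ^ s)) (g x) ⟩
    Δ2^ (suc s) g x - + 2 * Δ2^ s g x ∎
    where
    open ≡-Reasoning
    lemma : ∀ a b c → (a - b) - (b - c) ≡ (a - c) - + 2 * (b - c)
    lemma = solve-∀

  Δ^-inner : ℕ → Seq → Seq
  Δ^-inner n ψ x = ∑< (n ∸ 1) (λ i → binomialWeight n (suc i) * (ψ (x ℕ.+ suc i) - ψ x))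

  Δ^-const : ∀ n c x → Δ^ (suc n) (λ _ → c) x ≡ 0ℤ
  Δ^-const zero    c x = ℤ.+-inverseʳ c
  Δ^-const (suc n) c x rewrite Δ^-const n c (suc x) | Δ^-const n c x = refl

  Δ^-split : ∀ n g x → Δ^ (suc n) g x ≡ Δ^-inner (suc n) g x + (g (x ℕ.+ suc n) - g x)
  Δ^-split n g x = begin
    Δ^ (suc n) g x
      ≡⟨ ℤ.+-identityʳ _ ⟨
    Δ^ (suc n) g x - 0ℤ
      ≡⟨ cong (λ c → Δ^ (suc n) g x - c) (Δ^-const n (g x) x) ⟨
    Δ^ (suc n) g x - Δ^ (suc n) (λ _ → g x) x
      ≡⟨ cong₂ _-_ (Δ^-newton (suc n) g x) (Δ^-newton (suc n) (λ _ → g x) x) ⟩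
    ∑< (suc (suc n)) (λ i → w i * g (x ℕ.+ i)) - ∑< (suc (suc n)) (λ i → w i * g x)
      ≡⟨ ∑<-- (suc (suc n)) (λ i → w i * g (x ℕ.+ i)) (λ i → w i * g x) ⟨
    ∑< (suc (suc n)) (λ i → w i * g (x ℕ.+ i) - w i * g x)
      ≡⟨ ∑<-cong (suc (suc n)) (λ i → sym (*-distribˡ-- (w i) (g (x ℕ.+ i)) (g x))) ⟩
    w 0 * (g (x ℕ.+ 0) - g x) + ∑< (suc n) (λ i → w (suc i) * (g (x ℕ.+ suc i) - g x))
      ≡⟨ cong₂ _+_ first (∑<-suc n (λ i → w (suc i) * (g (x ℕ.+ suc i) - g x))) ⟩
    0ℤ + (Δ^-inner (suc n) g x + w (suc n) * (g (x ℕ.+ suc n) - g x))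
      ≡⟨ cong (λ c → 0ℤ + (Δ^-inner (suc n) g x + c * (g (x ℕ.+ suc n) - g x))) last ⟩
    0ℤ + (Δ^-inner (suc n) g x + 1ℤ * (g (x ℕ.+ suc n) - g x))
      ≡⟨ lemma (Δ^-inner (suc n) g x) (g (x ℕ.+ suc n) - g x) ⟩
    Δ^-inner (suc n) g x + (g (x ℕ.+ suc n) - g x)
      ∎
    where
    open ≡-Reasoning
    w = binomialWeight (suc n)
    first : w 0 * (g (x ℕ.+ 0) - g x) ≡ 0ℤ
    first = trans (cong (λ y → w 0 * (g y - g x)) (ℕ.+-identityʳ x))
                  (trans (cong (w 0 *_) (ℤ.+-inverseʳ (g x))) (ℤ.*-zeroʳ (w 0)))
    last : w (suc n) ≡ 1ℤ
    last = trans (cong (λ m → signed m (+ (suc n C suc n))) (ℕ.n∸n≡0 n)) (cong +_ (nCn≡1 (suc n)))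
    lemma : ∀ a b → 0ℤ + (a + 1ℤ * b) ≡ a + b
    lemma = solve-∀

  Δ^2^-split : ∀ r g x → Δ^ (2 ^ r) g x ≡ Δ^-inner (2 ^ r) g x + Δ2^ r g x
  Δ^2^-split r g x with 2 ^ r | ℕ.m^n>0 2 r
  ... | suc n | _ = Δ^-split n g x

  Δ^-inner-cong : ∀ n {φ ψ} → (∀ y → φ y ≡ ψ y) → ∀ x → Δ^-inner n φ x ≡ Δ^-inner n ψ x
  Δ^-inner-cong n φ≗ψ x = ∑<-cong (n ∸ 1) (λ i → cong (binomialWeight n (suc i) *_) (cong₂ _-_ (φ≗ψ _) (φ≗ψ x)))

  Δ^-inner-+ : ∀ n φ ψ x → Δ^-inner n (λ y → φ y + ψ y) x ≡ Δ^-inner n φ x + Δ^-inner n ψ x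
  Δ^-inner-+ n φ ψ x = trans
    (∑<-cong (n ∸ 1) (λ i → lemma (binomialWeight n (suc i)) (φ (x ℕ.+ suc i)) (ψ (x ℕ.+ suc i)) (φ x) (ψ x)))
    (∑<-+ (n ∸ 1) (λ i → binomialWeight n (suc i) * (φ (x ℕ.+ suc i) - φ x))
                  (λ i → binomialWeight n (suc i) * (ψ (x ℕ.+ suc i) - ψ x)))
    where lemma : ∀ w p q r s → w * ((p + q) - (r + s)) ≡ w * (p - r) + w * (q - s)
          lemma = solve-∀

  Δ^-inner-step : ∀ n ψ s x → Δ^-inner n ψ (x ℕ.+ s) - Δ^-inner n ψ x ≡ Δ^-inner n (λ y → ψ (y ℕ.+ s) - ψ y) x
  Δ^-inner-step n ψ s x = begin
    Δ^-inner n ψ (x ℕ.+ s) - Δ^-inner n ψ x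
      ≡⟨ ∑<-- (n ∸ 1) (λ i → w i * (ψ (x ℕ.+ s ℕ.+ suc i) - ψ (x ℕ.+ s))) (λ i → w i * (ψ (x ℕ.+ suc i) - ψ x)) ⟨
    ∑< (n ∸ 1) (λ i → w i * (ψ (x ℕ.+ s ℕ.+ suc i) - ψ (x ℕ.+ s)) - w i * (ψ (x ℕ.+ suc i) - ψ x))
      ≡⟨ ∑<-cong (n ∸ 1) term ⟩
    Δ^-inner n (λ y → ψ (y ℕ.+ s) - ψ y) x                                      ∎
    where
    open ≡-Reasoning
    w = λ i → binomialWeight n (suc i)
    lemma : ∀ w p q r s → w * (p - r) - w * (q - s) ≡ w * ((p - q) - (r - s))
    lemma = solve-∀
    term : ∀ i → w i * (ψ (x ℕ.+ s ℕ.+ suc i) - ψ (x ℕ.+ s)) - w i * (ψ (x ℕ.+ suc i) - ψ x)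
               ≡ w i * ((ψ (x ℕ.+ suc i ℕ.+ s) - ψ (x ℕ.+ suc i)) - (ψ (x ℕ.+ s) - ψ x))
    term i rewrite ℕ.+-assoc x s (suc i) | ℕ.+-comm s (suc i) | sym (ℕ.+-assoc x (suc i) s) =
      lemma (w i) (ψ (x ℕ.+ suc i ℕ.+ s)) (ψ (x ℕ.+ suc i)) (ψ (x ℕ.+ s)) (ψ x)

  2^a*odd<2^r⇒a<r : ∀ {a c r} → 2 ^ a ℕ.* suc (2 ℕ.* c) < 2 ^ r → a < r
  2^a*odd<2^r⇒a<r {a} {c} {r} lt with a ℕ.<? r
  ... | yes a<r = a<r
  ... | no  a≮r = contradiction lt (ℕ.≤⇒≯ (ℕ.≤-trans (ℕ.^-monoʳ-≤ 2 (ℕ.≮⇒≥ a≮r)) (ℕ.m≤m*n (2 ^ a) (suc (2 ℕ.* c)))))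

  2^a*odd<2^r-cases : ∀ {a c r} → 2 ^ a ℕ.* suc (2 ℕ.* c) < 2 ^ r → suc a < r ⊎ (r ≡ suc a × c ≡ 0)
  2^a*odd<2^r-cases {a} {c} {r} lt with suc a ℕ.<? r
  ... | yes 1+a<r = inj₁ 1+a<r
  ... | no  1+a≮r with ℕ.≤-antisym (ℕ.≮⇒≥ 1+a≮r) (2^a*odd<2^r⇒a<r {a} {c} lt)
  ...   | refl = inj₂ (refl , odd<2⇒c≡0 c
    (ℕ.*-cancelˡ-< (2 ^ a) _ _ (subst (2 ^ a ℕ.* suc (2 ℕ.* c) <_) (ℕ.*-comm 2 (2 ^ a)) lt)))
    where odd<2⇒c≡0 : ∀ c → suc (2 ℕ.* c) < 2 → c ≡ 0
          odd<2⇒c≡0 zero    _ = refl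
          odd<2⇒c≡0 (suc c) (s≤s (s≤s ()))

  -- The term j = 2^a (2c + 1) gains r − a from C(2^r, j) and ν + a from ψ.
  Δ^-inner-≈0 : ∀ r ν ψ x →
    (∀ a c → 2 ^ a ℕ.* suc (2 ℕ.* c) < 2 ^ r → ψ (x ℕ.+ 2 ^ a ℕ.* suc (2 ℕ.* c)) ≈ ψ x [mod2^ ν ℕ.+ a ]) →
    Δ^-inner (2 ^ r) ψ x ≈ 0ℤ [mod2^ ν ℕ.+ r ]
  Δ^-inner-≈0 r ν ψ x ψ-steps = ∑<-≈0 (2 ^ r ∸ 1) _ λ i i<2^r-1 →
    term (suc i) (s≤s z≤n) (ℕ.m≤pred[n]⇒suc[m]≤n {{ℕ.m^n≢0 2 r}} i<2^r-1)
    where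
    term : ∀ j → 0 < j → j < 2 ^ r → binomialWeight (2 ^ r) j * (ψ (x ℕ.+ j) - ψ x) ≈ 0ℤ [mod2^ ν ℕ.+ r ]
    term j 0<j j<2^r with 2-adic-decomposition j 0<j
    ... | a , c , refl = subst (_≈ 0ℤ [mod2^ ν ℕ.+ r ]) (signed-*ˡ (2 ^ r ∸ j) (+ (2 ^ r C j)) (ψ (x ℕ.+ j) - ψ x))
          (signed-≈0 (2 ^ r ∸ j) (*-≈0-shift 2^a*C≈0 (≈⇒-≈0 (ψ-steps a c j<2^r))))
      where
      2^a*C≈0 : pow2ᶻ a * + (2 ^ r C j) ≈ 0ℤ [mod2^ r ]
      2^a*C≈0 = subst (_≈ 0ℤ [mod2^ r ]) (ℤ.pos-* (2 ^ a) (2 ^ r C j)) (∣⇒+≈0 (2^r∣2^a*2^rC[2^a*odd] r a c))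

  Δ^2^-step : ∀ r g x → Δ^ (2 ^ r) g (x ℕ.+ 2 ^ r) - Δ^ (2 ^ r) g x
                        ≡ Δ^-inner (2 ^ r) (Δ2^ r g) x + (Δ2^ r g (x ℕ.+ 2 ^ r) - Δ2^ r g x)
  Δ^2^-step r g x = begin
    Δ^ h g (x ℕ.+ h) - Δ^ h g x
      ≡⟨ cong₂ _-_ (Δ^2^-split r g (x ℕ.+ h)) (Δ^2^-split r g x) ⟩
    (I g (x ℕ.+ h) + Δ2^ r g (x ℕ.+ h)) - (I g x + Δ2^ r g x)
      ≡⟨ lemma (I g (x ℕ.+ h)) (Δ2^ r g (x ℕ.+ h)) (I g x) (Δ2^ r g x) ⟩
    (I g (x ℕ.+ h) - I g x) + (Δ2^ r g (x ℕ.+ h) - Δ2^ r g x)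
      ≡⟨ cong (_+ (Δ2^ r g (x ℕ.+ h) - Δ2^ r g x)) (Δ^-inner-step h g h x) ⟩
    I (Δ2^ r g) x + (Δ2^ r g (x ℕ.+ h) - Δ2^ r g x) ∎
    where
    open ≡-Reasoning
    h = 2 ^ r
    I = Δ^-inner h
    lemma : ∀ a b c d → (a + b) - (c + d) ≡ (a - c) + (b - d)
    lemma = solve-∀

  -- Δ^(2^(r+1)) = (Δ^-inner (2^r) + Δ2^ r)², and the two operators commute.
  Δ^2^[1+r]-expand : ∀ r g x → Δ^ (2 ^ suc r) g x
    ≡ Δ^-inner (2 ^ r) (Δ^-inner (2 ^ r) g) x + + 2 * Δ^-inner (2 ^ r) (Δ2^ r g) x + (Δ2^ r g (x ℕ.+ 2 ^ r) - Δ2^ r g x)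
  Δ^2^[1+r]-expand r g x = begin
    Δ^ (h ℕ.+ (h ℕ.+ 0)) g x                     ≡⟨ cong (λ n → Δ^ (h ℕ.+ n) g x) (ℕ.+-identityʳ h) ⟩
    Δ^ (h ℕ.+ h) g x                             ≡⟨ Δ^-+ h h g x ⟩
    Δ^ h (Δ^ h g) x                              ≡⟨ Δ^2^-split r (Δ^ h g) x ⟩
    I (Δ^ h g) x + Δ2^ r (Δ^ h g) x               ≡⟨ cong₂ _+_ I-Δ^ (Δ^2^-step r g x) ⟩
    (I (I g) x + I (Δ2^ r g) x) + (I (Δ2^ r g) x + LL) ≡⟨ lemma (I (I g) x) (I (Δ2^ r g) x) LL ⟩
    I (I g) x + + 2 * I (Δ2^ r g) x + LL          ∎
    where
    open ≡-Reasoning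
    h = 2 ^ r
    I = Δ^-inner h
    LL = Δ2^ r g (x ℕ.+ h) - Δ2^ r g x
    I-Δ^ : I (Δ^ h g) x ≡ I (I g) x + I (Δ2^ r g) x
    I-Δ^ = trans (Δ^-inner-cong h (Δ^2^-split r g) x) (Δ^-inner-+ h (I g) (Δ2^ r g) x)
    lemma : ∀ a b c → (a + b) + (b + c) ≡ a + + 2 * b + c
    lemma = solve-∀

  Δ^-≈0-below : ∀ {k h} (ψ : Seq) → (∀ m → m < h → Δ^ m ψ 0 ≈ 0ℤ [mod2^ k ]) → ∀ x m → x ℕ.+ m < h → Δ^ m ψ x ≈ 0ℤ [mod2^ k ]
  Δ^-≈0-below ψ Δ^ψ0≈0 zero    m m<h = Δ^ψ0≈0 m m<h
  Δ^-≈0-below {k} {h} ψ Δ^ψ0≈0 (suc x) m 1+x+m<h =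
    subst (_≈ 0ℤ [mod2^ k ]) (lemma (Δ^ m ψ (suc x)) (Δ^ m ψ x))
      (+-cong (Δ^-≈0-below ψ Δ^ψ0≈0 x (suc m) (subst (_< h) (sym (ℕ.+-suc x m)) 1+x+m<h))
              (Δ^-≈0-below ψ Δ^ψ0≈0 x m (ℕ.<-trans (ℕ.n<1+n _) 1+x+m<h)))
    where lemma : ∀ a b → (a - b) + b ≡ a
          lemma = solve-∀

  periodic-≈0 : ∀ {k h} .{{_ : NonZero h}} (ψ : Seq) → (∀ x → ψ (x ℕ.+ h) ≈ ψ x [mod2^ k ]) →
    (∀ x → x < h → ψ x ≈ 0ℤ [mod2^ k ]) → ∀ x → ψ x ≈ 0ℤ [mod2^ k ]
  periodic-≈0 {k} {h} ψ periodic ψ≈0 x =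
    subst (λ y → ψ y ≈ 0ℤ [mod2^ k ]) (sym (m≡m%n+[m/n]*n x h)) (shifted (x / h) (m%n<n x h))
    where
    shifted : ∀ q {y} → y < h → ψ (y ℕ.+ q ℕ.* h) ≈ 0ℤ [mod2^ k ]
    shifted zero    {y} y<h = subst (λ z → ψ z ≈ 0ℤ [mod2^ k ]) (sym (ℕ.+-identityʳ y)) (ψ≈0 y y<h)
    shifted (suc q) {y} y<h = subst (λ z → ψ z ≈ 0ℤ [mod2^ k ])
      (trans (ℕ.+-assoc y (q ℕ.* h) h) (cong (y ℕ.+_) (ℕ.+-comm (q ℕ.* h) h)))
      (≈-trans (periodic (y ℕ.+ q ℕ.* h)) (shifted q y<h))

  -- The residue sequences x ↦ f(x) mod 2^K are Lipschitz only up to the level K.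
  LipschitzMod2^ : ℕ → Seq → Set
  LipschitzMod2^ K g = ∀ {m} → m ≤ K → ∀ x d → g (x ℕ.+ 2 ^ m ℕ.* d) ≈ g x [mod2^ m ]

  module _ {K : ℕ} {g : Seq} (lip : LipschitzMod2^ K g) where

    private
      ≈0-both : ∀ {k a b} → a ≈ 0ℤ [mod2^ k ] → b ≈ 0ℤ [mod2^ k ] → a ≈ b [mod2^ k ]
      ≈0-both a≈0 b≈0 = ≈-trans a≈0 (≈-sym b≈0)

    Δ2^-≈0 : ∀ {s} → s ≤ K → ∀ x → Δ2^ s g x ≈ 0ℤ [mod2^ s ]
    Δ2^-≈0 {s} s≤K x = ≈⇒-≈0 (subst (λ y → g (x ℕ.+ y) ≈ g x [mod2^ s ]) (ℕ.*-identityʳ (2 ^ s)) (lip s≤K x 1))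

    Δ2^-periodic-suc : ∀ {s} → suc s ≤ K → ∀ x → Δ2^ s g (x ℕ.+ 2 ^ s) ≈ Δ2^ s g x [mod2^ suc s ]
    Δ2^-periodic-suc {s} 1+s≤K x = -≈0⇒≈ (subst (_≈ 0ℤ [mod2^ suc s ]) (sym (Δ2^-twice s g x))
      (≈⇒-≈0 (≈-trans (Δ2^-≈0 1+s≤K x) (≈-sym (≈-scale {1} (Δ2^-≈0 (ℕ.<⇒≤ 1+s≤K) x))))))

    Δ^-inner-≈0-Lipschitz : ∀ {r} → r ≤ K → ∀ x → Δ^-inner (2 ^ r) g x ≈ 0ℤ [mod2^ r ]
    Δ^-inner-≈0-Lipschitz {r} r≤K x = Δ^-inner-≈0 r 0 g x λ a c lt →
      lip (ℕ.≤-trans (ℕ.<⇒≤ (2^a*odd<2^r⇒a<r {a} {c} lt)) r≤K) x (suc (2 ℕ.* c))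

    Δ^-inner-Δ2^-≈0 : ∀ {r} → r ≤ K → ∀ x → Δ^-inner (2 ^ r) (Δ2^ r g) x ≈ 0ℤ [mod2^ suc r ]
    Δ^-inner-Δ2^-≈0 {r} r≤K x = Δ^-inner-≈0 r 1 (Δ2^ r g) x λ a c lt →
      ≈-weaken (2^a*odd<2^r⇒a<r {a} {c} lt) (≈0-both (Δ2^-≈0 r≤K _) (Δ2^-≈0 r≤K x))

    -- Only j = 2^(r−1) escapes the bound of Δ^-inner-≈0-Lipschitz; shifting by it turns
    -- Δ^-inner g into Δ^-inner (Δ2^ (r − 1) g).
    Δ^-inner²-≈0 : ∀ {r} → r ≤ K → ∀ x → Δ^-inner (2 ^ r) (Δ^-inner (2 ^ r) g) x ≈ 0ℤ [mod2^ 2 ℕ.+ r ]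
    Δ^-inner²-≈0 {r} r≤K x = Δ^-inner-≈0 r 2 (Δ^-inner (2 ^ r) g) x λ a c lt → steps a c lt
      where
      2^a*1≡2^a : ∀ a → 2 ^ a ℕ.* suc (2 ℕ.* 0) ≡ 2 ^ a
      2^a*1≡2^a a = ℕ.*-identityʳ (2 ^ a)
      steps : ∀ a c → 2 ^ a ℕ.* suc (2 ℕ.* c) < 2 ^ r →
        Δ^-inner (2 ^ r) g (x ℕ.+ 2 ^ a ℕ.* suc (2 ℕ.* c)) ≈ Δ^-inner (2 ^ r) g x [mod2^ 2 ℕ.+ a ]
      steps a c lt with 2^a*odd<2^r-cases {a} {c} lt
      ... | inj₁ 1+a<r = ≈-weaken 1+a<r (≈0-both (Δ^-inner-≈0-Lipschitz r≤K _) (Δ^-inner-≈0-Lipschitz r≤K x))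
      ... | inj₂ (refl , refl) rewrite 2^a*1≡2^a a =
        -≈0⇒≈ (subst (_≈ 0ℤ [mod2^ 2 ℕ.+ a ]) (sym (Δ^-inner-step (2 ^ suc a) g (2 ^ a) x))
          (Δ^-inner-≈0 (suc a) 1 (Δ2^ a g) x λ b c′ lt′ → steps′ b c′ lt′))
        where
        steps′ : ∀ b c′ → 2 ^ b ℕ.* suc (2 ℕ.* c′) < 2 ^ suc a →
          Δ2^ a g (x ℕ.+ 2 ^ b ℕ.* suc (2 ℕ.* c′)) ≈ Δ2^ a g x [mod2^ suc b ]
        steps′ b c′ lt′ with 2^a*odd<2^r-cases {b} {c′} lt′
        ... | inj₁ 1+b<1+a = ≈-weaken (ℕ.≤-pred 1+b<1+a)
                               (≈0-both (Δ2^-≈0 (ℕ.<⇒≤ r≤K) _) (Δ2^-≈0 (ℕ.<⇒≤ r≤K) x))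
        ... | inj₂ (refl , refl) rewrite 2^a*1≡2^a a = Δ2^-periodic-suc r≤K x

    Δ^2^-periodic : ∀ {r} → suc r ≤ K → ∀ x → Δ^ (2 ^ r) g (x ℕ.+ 2 ^ r) ≈ Δ^ (2 ^ r) g x [mod2^ suc r ]
    Δ^2^-periodic {r} 1+r≤K x = -≈0⇒≈ (subst (_≈ 0ℤ [mod2^ suc r ]) (sym (Δ^2^-step r g x))
      (+-cong (Δ^-inner-Δ2^-≈0 (ℕ.<⇒≤ 1+r≤K) x) (≈⇒-≈0 (Δ2^-periodic-suc 1+r≤K x))))

    Δ^2^[1+r]≈ : ∀ {r} → suc r ≤ K → ∀ x →
      Δ^ (2 ^ suc r) g x ≈ Δ2^ r g (x ℕ.+ 2 ^ r) - Δ2^ r g x [mod2^ 2 ℕ.+ r ]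
    Δ^2^[1+r]≈ {r} 1+r≤K x = ≈-trans (≈-reflexive (Δ^2^[1+r]-expand r g x))
      (≈-trans (+-cong (+-cong (Δ^-inner²-≈0 r≤K x) (≈-scale {1} (Δ^-inner-Δ2^-≈0 r≤K x))) ≈-refl)
               (≈-reflexive (ℤ.+-identityˡ _)))
      where r≤K = ℕ.<⇒≤ 1+r≤K

    Δ2^-periodic⇒Δ^≈0 : ∀ {s} → suc s ≤ K → (∀ x → Δ2^ s g (x ℕ.+ 2 ^ s) ≈ Δ2^ s g x [mod2^ 2 ℕ.+ s ]) →
      ∀ n → 2 ^ suc s ≤ n → Δ^ n g 0 ≈ 0ℤ [mod2^ 2 ℕ.+ s ]
    Δ2^-periodic⇒Δ^≈0 {s} 1+s≤K Δ2^-periodic n 2^[1+s]≤n = subst (_≈ 0ℤ [mod2^ 2 ℕ.+ s ])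
      (trans (sym (Δ^-+ (n ∸ 2 ^ suc s) (2 ^ suc s) g 0)) (cong (λ m → Δ^ m g 0) (ℕ.m∸n+n≡m 2^[1+s]≤n)))
      (Δ^-≈0 (n ∸ 2 ^ suc s) (λ y → ≈-trans (Δ^2^[1+r]≈ 1+s≤K y) (≈⇒-≈0 (Δ2^-periodic y))) 0)

    Δ^≈0⇒Δ2^-periodic : ∀ {s} → suc (suc s) ≤ K →
      (∀ n → 2 ^ suc s ≤ n → n < 2 ^ suc (suc s) → Δ^ n g 0 ≈ 0ℤ [mod2^ 2 ℕ.+ s ]) →
      ∀ x → Δ2^ s g (x ℕ.+ 2 ^ s) ≈ Δ2^ s g x [mod2^ 2 ℕ.+ s ]
    Δ^≈0⇒Δ2^-periodic {s} 2+s≤K Δ^≈0 x = -≈0⇒≈ (≈-trans (≈-sym (Δ^2^[1+r]≈ (ℕ.<⇒≤ 2+s≤K) x)) (ψ≈0 x))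
      where
      h = 2 ^ suc s
      ψ = Δ^ h g
      initial : ∀ m → m < h → Δ^ m ψ 0 ≈ 0ℤ [mod2^ 2 ℕ.+ s ]
      initial m m<h = subst (_≈ 0ℤ [mod2^ 2 ℕ.+ s ]) (Δ^-+ m h g 0)
        (Δ^≈0 (m ℕ.+ h) (ℕ.m≤n+m h m) (subst (m ℕ.+ h <_) (cong (h ℕ.+_) (sym (ℕ.+-identityʳ h))) (ℕ.+-monoˡ-< h m<h)))
      ψ≈0 : ∀ x → ψ x ≈ 0ℤ [mod2^ 2 ℕ.+ s ]
      ψ≈0 = periodic-≈0 {{ℕ.m^n≢0 2 (suc s)}} ψ (Δ^2^-periodic 2+s≤K)
        (λ y y<h → Δ^-≈0-below ψ initial y 0 (subst (_< h) (sym (ℕ.+-identityʳ y)) y<h))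

module TwoAdic where
  open import Data.Nat as ℕ using (ℕ; zero; suc; _≤_; _<_; z≤n; s≤s; _∸_; _^_; _%_; _/_; _≤ᵇ_; _≡ᵇ_)
  import Data.Nat.Properties as ℕ
  import Data.Nat.Divisibility as ℕ
  import Data.Nat.Tactic.RingSolver as ℕ
  open import Data.Nat.DivMod using (m≡m%n+[m/n]*n; m%n<n; m∣n⇒o%n%m≡o%m; m≤n⇒[n∸m]%m≡n%m; m<n⇒m%n≡m; n%1≡0)
  open import Data.Nat.Combinatorics using (_C_)
  open import Data.Bool using (true; false; if_then_else_; T)
  open import Data.Integer using (ℤ; +_; _+_; _-_; _*_; -_; 0ℤ; 1ℤ)
  import Data.Integer.Properties as ℤ
  open import Data.Integer.Divisibility.Signed using (_∣_; divides; ∣⇒∣ᵤ)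
  open import Data.Integer.Tactic.RingSolver using (solve-∀)
  open import Data.List using (foldr; applyUpTo)
  open import Data.List.Properties using (map-applyUpTo)
  open import Data.Product using (_,_)
  open import Data.Sum using (inj₁; inj₂)
  open import Relation.Nullary using (contradiction)
  open import Relation.Binary.PropositionalEquality
  open Congruence
  open BinomialValuation using (even-or-odd)
  open Sequences

  resᶻ : ℤ₂ → ℕ → ℤ
  resᶻ x k = + res x k

  res<2^ : ∀ x k → res x k < 2 ^ k
  res<2^ x zero    = s≤s z≤n
  res<2^ x (suc k) with x k
  ... | true  = subst (res x k ℕ.+ 2 ^ k <_) (cong (2 ^ k ℕ.+_) (sym (ℕ.+-identityʳ (2 ^ k)))) (ℕ.+-monoˡ-< (2 ^ k) (res<2^ x k))
  ... | false = subst (_< 2 ^ suc k) (sym (ℕ.+-identityʳ (res x k))) (ℕ.<-≤-trans (res<2^ x k) (ℕ.m≤m+n (2 ^ k) _))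

  resᶻ-suc : ∀ x k → resᶻ x (suc k) ≈ resᶻ x k [mod2^ k ]
  resᶻ-suc x k with x k
  ... | true  = ∣⇒≈ (divides 1ℤ (trans (cong (_- resᶻ x k) (ℤ.pos-+ (res x k) (2 ^ k))) (lemma (resᶻ x k) (pow2ᶻ k))))
    where lemma : ∀ a p → a + p - a ≡ 1ℤ * p
          lemma = solve-∀
  ... | false = ≈-reflexive (cong +_ (ℕ.+-identityʳ (res x k)))

  resᶻ-weaken : ∀ x {j k} → j ≤ k → resᶻ x k ≈ resᶻ x j [mod2^ j ]
  resᶻ-weaken x {j} j≤k with ℕ.m≤n⇒∃[o]m+o≡n j≤k
  ... | d , refl = go d
    where
    go : ∀ d → resᶻ x (j ℕ.+ d) ≈ resᶻ x j [mod2^ j ]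
    go zero    = ≈-reflexive (cong (resᶻ x) (ℕ.+-identityʳ j))
    go (suc d) = ≈-trans (subst (λ k → resᶻ x k ≈ resᶻ x (j ℕ.+ d) [mod2^ j ]) (sym (ℕ.+-suc j d))
                           (≈-weaken (ℕ.m≤m+n j d) (resᶻ-suc x (j ℕ.+ d))))
                         (go d)

  small-multiple≡0 : ∀ {k n} → n < 2 ^ k → 2 ^ k ℕ.∣ n → n ≡ 0
  small-multiple≡0 {n = zero}  _   _      = refl
  small-multiple≡0 {n = suc n} n<2^k 2^k∣n = contradiction 2^k∣n (ℕ.>⇒∤ n<2^k)

  +≈+⇒≡-≥ : ∀ {k a b} → b ≤ a → a < 2 ^ k → + a ≈ + b [mod2^ k ] → a ≡ b
  +≈+⇒≡-≥ {k} {a} {b} b≤a a<2^k (∣⇒≈ 2^k∣a-b) = ℕ.≤-antisym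
    (ℕ.m∸n≡0⇒m≤n (small-multiple≡0 {k} (ℕ.≤-<-trans (ℕ.m∸n≤m a b) a<2^k)
      (∣⇒∣ᵤ (subst (pow2ᶻ k ∣_) (trans (ℤ.m-n≡m⊖n a b) (ℤ.⊖-≥ b≤a)) 2^k∣a-b))))
    b≤a

  +≈+⇒≡ : ∀ {k a b} → a < 2 ^ k → b < 2 ^ k → + a ≈ + b [mod2^ k ] → a ≡ b
  +≈+⇒≡ {k} {a} {b} a<2^k b<2^k a≈b with ℕ.≤-total b a
  ... | inj₁ b≤a = +≈+⇒≡-≥ b≤a a<2^k a≈b
  ... | inj₂ a≤b = sym (+≈+⇒≡-≥ a≤b b<2^k (≈-sym a≈b))

  ≈⇒≡[mod2^] : ∀ {x y k} → resᶻ x k ≈ resᶻ y k [mod2^ k ] → x ≡[mod2^ k ] y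
  ≈⇒≡[mod2^] {x} {y} {k} = +≈+⇒≡ (res<2^ x k) (res<2^ y k)

  mod2^-≈ : ∀ k a → + mod2^ k a ≈ + a [mod2^ k ]
  mod2^-≈ k a = ∣⇒≈ (divides (- + q) (begin
    + r - + a                          ≡⟨ cong (λ b → + r - + b) (m≡m%n+[m/n]*n a (2 ^ k)) ⟩
    + r - + (r ℕ.+ q ℕ.* 2 ^ k)          ≡⟨ cong (λ b → + r - b) (trans (ℤ.pos-+ r (q ℕ.* 2 ^ k)) (cong (λ b → + r + b) (ℤ.pos-* q (2 ^ k)))) ⟩
    + r - (+ r + + q * pow2ᶻ k)          ≡⟨ lemma (+ r) (+ q) (pow2ᶻ k) ⟩
    - + q * pow2ᶻ k                    ∎))
    where
    instance _ = ℕ.m^n≢0 2 k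
    open ≡-Reasoning
    r = a % 2 ^ k
    q = a / 2 ^ k
    lemma : ∀ r q p → r - (r + q * p) ≡ - q * p
    lemma = solve-∀

  split-at-2^ : ∀ k z → z < 2 ^ suc k → z ≡ mod2^ k z ℕ.+ (if 2 ^ k ≤ᵇ z then 2 ^ k else 0)
  split-at-2^ k z z<2^[1+k] with 2 ^ k ≤ᵇ z in bit
  ... | true  = begin
    z                              ≡⟨ ℕ.m∸n+n≡m 2^k≤z ⟨
    z ∸ 2 ^ k ℕ.+ 2 ^ k             ≡⟨ cong (ℕ._+ 2 ^ k) (m<n⇒m%n≡m z∸2^k<2^k) ⟨
    (z ∸ 2 ^ k) % 2 ^ k ℕ.+ 2 ^ k   ≡⟨ cong (ℕ._+ 2 ^ k) (m≤n⇒[n∸m]%m≡n%m 2^k≤z) ⟩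
    mod2^ k z ℕ.+ 2 ^ k             ∎
    where
    open ≡-Reasoning
    instance _ = ℕ.m^n≢0 2 k
    2^k≤z : 2 ^ k ≤ z
    2^k≤z = ℕ.≤ᵇ⇒≤ (2 ^ k) z (subst T (sym bit) _)
    z∸2^k<2^k : z ∸ 2 ^ k < 2 ^ k
    z∸2^k<2^k = subst (z ∸ 2 ^ k <_) (ℕ.m+n∸n≡m (2 ^ k) (2 ^ k))
      (ℕ.∸-monoˡ-< (subst (z <_) (cong (2 ^ k ℕ.+_) (ℕ.+-identityʳ (2 ^ k))) z<2^[1+k]) 2^k≤z)
  ... | false = trans (sym (m<n⇒m%n≡m z<2^k)) (sym (ℕ.+-identityʳ _))
    where
    instance _ = ℕ.m^n≢0 2 k
    z<2^k : z < 2 ^ k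
    z<2^k = ℕ.≰⇒> (λ 2^k≤z → subst T bit (ℕ.≤⇒≤ᵇ 2^k≤z))

  mod2^-bit : ∀ k y → mod2^ (suc k) y ≡ mod2^ k y ℕ.+ (if 2 ^ k ≤ᵇ mod2^ (suc k) y then 2 ^ k else 0)
  mod2^-bit k y = trans (split-at-2^ k z (m%n<n y (2 ^ suc k)))
    (cong (ℕ._+ (if 2 ^ k ≤ᵇ z then 2 ^ k else 0)) (m∣n⇒o%n%m≡o%m (2 ^ k) (2 ^ suc k) y (ℕ.divides 2 refl)))
    where
    instance _ = ℕ.m^n≢0 2 k
             _ = ℕ.m^n≢0 2 (suc k)
    z = mod2^ (suc k) y

  Compatible : (ℕ → ℕ) → Set
  Compatible r = ∀ k → + r (suc k) ≈ + r k [mod2^ k ]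

  res-fromRes : ∀ {r} → Compatible r → ∀ k → res (fromRes r) k ≡ mod2^ k (r k)
  res-fromRes {r} compat zero    = sym (n%1≡0 (r 0))
  res-fromRes {r} compat (suc k) = begin
    res (fromRes r) k ℕ.+ bit           ≡⟨ cong (ℕ._+ bit) (res-fromRes compat k) ⟩
    mod2^ k (r k) ℕ.+ bit               ≡⟨ cong (ℕ._+ bit) (+≈+⇒≡ (m%n<n (r k) (2 ^ k)) (m%n<n (r (suc k)) (2 ^ k)) same-mod) ⟩
    mod2^ k (r (suc k)) ℕ.+ bit         ≡⟨ mod2^-bit k (r (suc k)) ⟨
    mod2^ (suc k) (r (suc k))           ∎
    where
    open ≡-Reasoning
    instance _ = ℕ.m^n≢0 2 k
    bit = if fromRes r k then 2 ^ k else 0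
    same-mod : + mod2^ k (r k) ≈ + mod2^ k (r (suc k)) [mod2^ k ]
    same-mod = ≈-trans (mod2^-≈ k (r k)) (≈-trans (≈-sym (compat k)) (≈-sym (mod2^-≈ k (r (suc k)))))

  resᶻ-fromRes : ∀ {r} → Compatible r → ∀ k → resᶻ (fromRes r) k ≈ + r k [mod2^ k ]
  resᶻ-fromRes {r} compat k = subst (_≈ + r k [mod2^ k ]) (cong +_ (sym (res-fromRes compat k))) (mod2^-≈ k (r k))

  resᶻ-ℕ→ℤ₂ : ∀ n k → resᶻ (ℕ→ℤ₂ n) k ≈ + n [mod2^ k ]
  resᶻ-ℕ→ℤ₂ n = resᶻ-fromRes (λ _ → ≈-refl)

  resᶻ-+₂ : ∀ x y k → resᶻ (x +₂ y) k ≈ resᶻ x k + resᶻ y k [mod2^ k ]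
  resᶻ-+₂ x y k = subst (resᶻ (x +₂ y) k ≈_[mod2^ k ]) (ℤ.pos-+ (res x k) (res y k)) (resᶻ-fromRes compat k)
    where
    compat : Compatible (λ k → res x k ℕ.+ res y k)
    compat k = subst₂ _≈_[mod2^ k ] (sym (ℤ.pos-+ (res x (suc k)) (res y (suc k)))) (sym (ℤ.pos-+ (res x k) (res y k)))
      (+-cong (resᶻ-suc x k) (resᶻ-suc y k))

  resᶻ-*₂ : ∀ x y k → resᶻ (x *₂ y) k ≈ resᶻ x k * resᶻ y k [mod2^ k ]
  resᶻ-*₂ x y k = subst (resᶻ (x *₂ y) k ≈_[mod2^ k ]) (ℤ.pos-* (res x k) (res y k)) (resᶻ-fromRes compat k)
    where
    compat : Compatible (λ k → res x k ℕ.* res y k)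
    compat k = subst₂ _≈_[mod2^ k ] (sym (ℤ.pos-* (res x (suc k)) (res y (suc k)))) (sym (ℤ.pos-* (res x k) (res y k)))
      (*-cong (resᶻ-suc x k) (resᶻ-suc y k))

  2^k∸res≈-res : ∀ x {j k} → j ≤ k → + (2 ^ k ∸ res x k) ≈ - resᶻ x j [mod2^ j ]
  2^k∸res≈-res x {j} {k} j≤k = subst (_≈ - resᶻ x j [mod2^ j ]) (sym 2^k∸res≡)
    (≈-trans (+-cong (≈-weaken j≤k (pow2ᶻ≈0 k)) (-‿cong (resᶻ-weaken x j≤k))) (≈-reflexive (ℤ.+-identityˡ _)))
    where
    2^k∸res≡ : + (2 ^ k ∸ res x k) ≡ pow2ᶻ k - resᶻ x k
    2^k∸res≡ = trans (sym (ℤ.⊖-≥ (ℕ.<⇒≤ (res<2^ x k)))) (sym (ℤ.m-n≡m⊖n (2 ^ k) (res x k)))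

  resᶻ--₂ : ∀ x k → resᶻ (-₂ x) k ≈ - resᶻ x k [mod2^ k ]
  resᶻ--₂ x k = ≈-trans (resᶻ-fromRes compat k) (2^k∸res≈-res x ℕ.≤-refl)
    where
    compat : Compatible (λ k → 2 ^ k ∸ res x k)
    compat k = ≈-trans (2^k∸res≈-res x (ℕ.n≤1+n k)) (≈-sym (2^k∸res≈-res x ℕ.≤-refl))

  resSeq : (ℤ₂ → ℤ₂) → ℕ → Seq
  resSeq f K x = resᶻ (f (ℕ→ℤ₂ x)) K

  resᶻ-ℕ→ℤ₂*₂ : ∀ n y k → resᶻ (ℕ→ℤ₂ n *₂ y) k ≈ + n * resᶻ y k [mod2^ k ]
  resᶻ-ℕ→ℤ₂*₂ n y k = ≈-trans (resᶻ-*₂ (ℕ→ℤ₂ n) y k) (*-cong (resᶻ-ℕ→ℤ₂ n k) ≈-refl)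

  resᶻ-foldr : ∀ {k φ ψ} m → (∀ i → resᶻ (φ i) k ≈ ψ i [mod2^ k ]) →
    resᶻ (foldr _+₂_ 0ℤ₂ (applyUpTo φ m)) k ≈ ∑< m ψ [mod2^ k ]
  resᶻ-foldr {k}         zero    φ≈ψ = resᶻ-ℕ→ℤ₂ 0 k
  resᶻ-foldr {k} {φ} {ψ} (suc m) φ≈ψ = ≈-trans (resᶻ-+₂ (φ 0) _ k) (+-cong (φ≈ψ 0) (resᶻ-foldr m (λ i → φ≈ψ (suc i))))

  resᶻ-mahlerTerm : ∀ f n i k → resᶻ (mahlerTerm f n i) k ≈ binomialWeight n i * resSeq f k i [mod2^ k ]
  resᶻ-mahlerTerm f n i k with (n ∸ i) % 2 ≡ᵇ 0
  ... | true  = resᶻ-ℕ→ℤ₂*₂ (n C i) (f (ℕ→ℤ₂ i)) k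
  ... | false = ≈-trans (resᶻ--₂ _ k)
    (≈-trans (-‿cong (resᶻ-ℕ→ℤ₂*₂ (n C i) (f (ℕ→ℤ₂ i)) k)) (≈-reflexive (ℤ.neg-distribˡ-* (+ (n C i)) (resSeq f k i))))

  resᶻ-mahler : ∀ f n k → resᶻ (mahler f n) k ≈ Δ^ n (resSeq f k) 0 [mod2^ k ]
  resᶻ-mahler f n k = begin
    resᶻ (mahler f n) k
      ≡⟨ cong (λ l → resᶻ (foldr _+₂_ 0ℤ₂ l) k) (map-applyUpTo (λ i → i) (mahlerTerm f n) (suc n)) ⟩
    resᶻ (foldr _+₂_ 0ℤ₂ (applyUpTo (mahlerTerm f n) (suc n))) k
      ≈⟨ resᶻ-foldr (suc n) (λ i → resᶻ-mahlerTerm f n i k) ⟩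
    ∑< (suc n) (λ i → binomialWeight n i * resSeq f k i)
      ≡⟨ Δ^-newton n (resSeq f k) 0 ⟨
    Δ^ n (resSeq f k) 0 ∎
    where open ≈-Reasoning k

  resᶻ-affine : ∀ u s h K → resᶻ (u +₂ (pow2 s *₂ h)) K ≈ resᶻ u K + pow2ᶻ s * resᶻ h K [mod2^ K ]
  resᶻ-affine u s h K = ≈-trans (resᶻ-+₂ u _ K) (+-congˡ (resᶻ u K) (resᶻ-ℕ→ℤ₂*₂ (2 ^ s) h K))

  module _ (f : ℤ₂ → ℤ₂) {k s : ℕ} {u h d : ℤ₂} {m : ℕ} where

    private
      N = k ℕ.+ s ℕ.+ m
      F : ℤ₂ → ℤ
      F y = resᶻ (f y) N

      H D : ℤ
      H = resᶻ h N
      D = resᶻ d N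
      lhs≈ : resᶻ (pow2 m *₂ f (u +₂ (pow2 s *₂ h))) N ≈ pow2ᶻ m * F (u +₂ (pow2 s *₂ h)) [mod2^ N ]
      lhs≈ = resᶻ-ℕ→ℤ₂*₂ (2 ^ m) (f (u +₂ (pow2 s *₂ h))) N
      rhs≈ : resᶻ ((pow2 m *₂ f u) +₂ (pow2 s *₂ (h *₂ d))) N ≈ pow2ᶻ m * F u + pow2ᶻ s * (H * D) [mod2^ N ]
      rhs≈ = ≈-trans (resᶻ-+₂ _ _ N)
        (+-cong (resᶻ-ℕ→ℤ₂*₂ (2 ^ m) (f u) N) (≈-trans (resᶻ-ℕ→ℤ₂*₂ (2 ^ s) (h *₂ d) N) (*-congˡ (pow2ᶻ s) (resᶻ-*₂ h d N))))

    DiffCongr⇒≈ : DiffCongr f k s u h (m , d) →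
      pow2ᶻ m * F (u +₂ (pow2 s *₂ h)) ≈ pow2ᶻ m * F u + pow2ᶻ s * (H * D) [mod2^ N ]
    DiffCongr⇒≈ congr = ≈-trans (≈-sym lhs≈) (≈-trans (≈-reflexive (cong +_ congr)) rhs≈)

    ≈⇒DiffCongr : pow2ᶻ m * F (u +₂ (pow2 s *₂ h)) ≈ pow2ᶻ m * F u + pow2ᶻ s * (H * D) [mod2^ N ] →
      DiffCongr f k s u h (m , d)
    ≈⇒DiffCongr congr = ≈⇒≡[mod2^] (≈-trans lhs≈ (≈-trans congr (≈-sym rhs≈)))

  StepDoubling : (ℤ₂ → ℤ₂) → ℕ → Set
  StepDoubling f t = ∀ x → Δ2^ (suc t) (resSeq f (2 ℕ.+ t)) x ≈ + 2 * Δ2^ t (resSeq f (2 ℕ.+ t)) x [mod2^ 2 ℕ.+ t ]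

  module _ {f : ℤ₂ → ℤ₂} (lipF : OneLipschitz f) where

    OneLipschitz-≈ : ∀ {x y k} → resᶻ x k ≈ resᶻ y k [mod2^ k ] → resᶻ (f x) k ≈ resᶻ (f y) k [mod2^ k ]
    OneLipschitz-≈ {x} {y} {k} x≈y = ≈-reflexive (cong +_ (lipF x y k (≈⇒≡[mod2^] x≈y)))

    resSeq-Lipschitz : ∀ K → LipschitzMod2^ K (resSeq f K)
    resSeq-Lipschitz K {m} m≤K x d = begin
      resSeq f K (x ℕ.+ 2 ^ m ℕ.* d)      ≈⟨ resᶻ-weaken (f _) m≤K ⟩
      resSeq f m (x ℕ.+ 2 ^ m ℕ.* d)      ≈⟨ OneLipschitz-≈ args≈ ⟩
      resSeq f m x                        ≈⟨ resᶻ-weaken (f _) m≤K ⟨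
      resSeq f K x                        ∎
      where
      open ≈-Reasoning m
      args≈ : resᶻ (ℕ→ℤ₂ (x ℕ.+ 2 ^ m ℕ.* d)) m ≈ resᶻ (ℕ→ℤ₂ x) m [mod2^ m ]
      args≈ = begin
        resᶻ (ℕ→ℤ₂ (x ℕ.+ 2 ^ m ℕ.* d)) m  ≈⟨ resᶻ-ℕ→ℤ₂ _ m ⟩
        + (x ℕ.+ 2 ^ m ℕ.* d)              ≡⟨ trans (ℤ.pos-+ x (2 ^ m ℕ.* d)) (cong (λ y → + x + y) (ℤ.pos-* (2 ^ m) d)) ⟩
        + x + pow2ᶻ m * + d                ≈⟨ -≈0⇒≈ (∣⇒≈ (divides (+ d) (lemma (+ x) (pow2ᶻ m) (+ d)))) ⟩
        + x                                ≈⟨ resᶻ-ℕ→ℤ₂ x m ⟨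
        resᶻ (ℕ→ℤ₂ x) m                    ∎
        where lemma : ∀ x p d → x + p * d - x - 0ℤ ≡ d * p
              lemma = solve-∀

    resSeq-weaken : ∀ {j K} → j ≤ K → ∀ y → resSeq f K y ≈ resSeq f j y [mod2^ j ]
    resSeq-weaken j≤K y = resᶻ-weaken (f (ℕ→ℤ₂ y)) j≤K

    Δ2^-level : ∀ {j K} → j ≤ K → ∀ s x → Δ2^ s (resSeq f K) x ≈ Δ2^ s (resSeq f j) x [mod2^ j ]
    Δ2^-level j≤K s x = sub-cong (resSeq-weaken j≤K _) (resSeq-weaken j≤K x)

    StepDoubling-at : ∀ {t K} → StepDoubling f t → 2 ℕ.+ t ≤ K → ∀ x →
      Δ2^ (suc t) (resSeq f K) x ≈ + 2 * Δ2^ t (resSeq f K) x [mod2^ 2 ℕ.+ t ]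
    StepDoubling-at {t} {K} doubling 2+t≤K x = begin
      Δ2^ (suc t) (resSeq f K) x                   ≈⟨ Δ2^-level 2+t≤K (suc t) x ⟩
      Δ2^ (suc t) (resSeq f (2 ℕ.+ t)) x           ≈⟨ doubling x ⟩
      + 2 * Δ2^ t (resSeq f (2 ℕ.+ t)) x           ≈⟨ *-congˡ (+ 2) (Δ2^-level 2+t≤K t x) ⟨
      + 2 * Δ2^ t (resSeq f K) x                   ∎
      where open ≈-Reasoning (2 ℕ.+ t)

    StepDoubling⇒Δ2^-periodic : ∀ {t} → StepDoubling f t →
      ∀ x → Δ2^ t (resSeq f (2 ℕ.+ t)) (x ℕ.+ 2 ^ t) ≈ Δ2^ t (resSeq f (2 ℕ.+ t)) x [mod2^ 2 ℕ.+ t ]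
    StepDoubling⇒Δ2^-periodic {t} doubling x =
      -≈0⇒≈ (subst (_≈ 0ℤ [mod2^ 2 ℕ.+ t ]) (sym (Δ2^-twice t (resSeq f (2 ℕ.+ t)) x)) (≈⇒-≈0 (doubling x)))

    Δ2^-periodic⇒StepDoubling : ∀ {t} →
      (∀ x → Δ2^ t (resSeq f (2 ℕ.+ t)) (x ℕ.+ 2 ^ t) ≈ Δ2^ t (resSeq f (2 ℕ.+ t)) x [mod2^ 2 ℕ.+ t ]) → StepDoubling f t
    Δ2^-periodic⇒StepDoubling {t} periodic x =
      -≈0⇒≈ (subst (_≈ 0ℤ [mod2^ 2 ℕ.+ t ]) (Δ2^-twice t (resSeq f (2 ℕ.+ t)) x) (≈⇒-≈0 (periodic x)))

    mahler≡0⇒Δ^≈0 : ∀ n {k} → mahler f n ≡[mod2^ k ] 0ℤ₂ → Δ^ n (resSeq f k) 0 ≈ 0ℤ [mod2^ k ]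
    mahler≡0⇒Δ^≈0 n {k} aₙ≡0 = ≈-trans (≈-sym (resᶻ-mahler f n k)) (≈-trans (≈-reflexive (cong +_ aₙ≡0)) (resᶻ-ℕ→ℤ₂ 0 k))

    Δ^≈0⇒mahler≡0 : ∀ n {k} → Δ^ n (resSeq f k) 0 ≈ 0ℤ [mod2^ k ] → mahler f n ≡[mod2^ k ] 0ℤ₂
    Δ^≈0⇒mahler≡0 n {k} Δ^≈0 = ≈⇒≡[mod2^] (≈-trans (resᶻ-mahler f n k) (≈-trans Δ^≈0 (≈-sym (resᶻ-ℕ→ℤ₂ 0 k))))

    private
      1+t+1≡2+t : ∀ t → suc t ℕ.+ 1 ≡ 2 ℕ.+ t
      1+t+1≡2+t t = ℕ.+-comm (suc t) 1

    mahler⇒StepDoubling : (∀ s → 2 ≤ s → ∀ n → 2 ^ s ≤ n → n < 2 ^ (s ℕ.+ 1) → mahler f n ≡[mod2^ (s ℕ.+ 1) ] 0ℤ₂) →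
      ∀ t → 1 ≤ t → StepDoubling f t
    mahler⇒StepDoubling aₙ≡0 t 1≤t = Δ2^-periodic⇒StepDoubling
      (Δ^≈0⇒Δ2^-periodic (resSeq-Lipschitz (2 ℕ.+ t)) ℕ.≤-refl λ n lo hi →
        mahler≡0⇒Δ^≈0 n (subst (λ k → mahler f n ≡[mod2^ k ] 0ℤ₂) (1+t+1≡2+t t)
          (aₙ≡0 (suc t) (s≤s 1≤t) n lo (subst (λ e → n < 2 ^ e) (sym (1+t+1≡2+t t)) hi))))

    StepDoubling⇒mahler : (∀ t → 1 ≤ t → StepDoubling f t) →
      ∀ s → 2 ≤ s → ∀ n → 2 ^ s ≤ n → n < 2 ^ (s ℕ.+ 1) → mahler f n ≡[mod2^ (s ℕ.+ 1) ] 0ℤ₂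
    StepDoubling⇒mahler doubling (suc t) (s≤s 1≤t) n lo _ =
      subst (λ k → mahler f n ≡[mod2^ k ] 0ℤ₂) (sym (1+t+1≡2+t t))
        (Δ^≈0⇒mahler≡0 n (Δ2^-periodic⇒Δ^≈0 (resSeq-Lipschitz (2 ℕ.+ t)) (ℕ.n≤1+n _)
          (StepDoubling⇒Δ2^-periodic (doubling t 1≤t)) n lo))

    DiffCongr-at-ℕ : ∀ {s x m d L} → DiffCongr f 1 s (ℕ→ℤ₂ x) (ℕ→ℤ₂ 1) (m , d) → 1 ℕ.+ s ℕ.+ m ≤ L →
      pow2ᶻ m * Δ2^ s (resSeq f L) x ≈ pow2ᶻ s * resᶻ d L [mod2^ 1 ℕ.+ s ℕ.+ m ]
    DiffCongr-at-ℕ {s} {x} {m} {d} {L} congr N≤L = begin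
      pow2ᶻ m * Δ2^ s (resSeq f L) x
        ≈⟨ *-congˡ (pow2ᶻ m) (sub-cong (≈-trans (resSeq-weaken N≤L _) (OneLipschitz-≈ args≈)) (resSeq-weaken N≤L x)) ⟩
      pow2ᶻ m * (F u′ - F u)
        ≡⟨ *-distribˡ-- (pow2ᶻ m) (F u′) (F u) ⟩
      pow2ᶻ m * F u′ - pow2ᶻ m * F u
        ≈⟨ sub-cong (DiffCongr⇒≈ f {1} {s} {u} {one} {d} {m} congr) ≈-refl ⟩
      pow2ᶻ m * F u + pow2ᶻ s * (resᶻ one N * resᶻ d N) - pow2ᶻ m * F u
        ≡⟨ lemma (pow2ᶻ m * F u) (pow2ᶻ s * (resᶻ one N * resᶻ d N)) ⟩
      pow2ᶻ s * (resᶻ one N * resᶻ d N)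
        ≈⟨ *-congˡ (pow2ᶻ s) (*-cong (resᶻ-ℕ→ℤ₂ 1 N) (≈-sym (resᶻ-weaken d N≤L))) ⟩
      pow2ᶻ s * (+ 1 * resᶻ d L)
        ≡⟨ cong (pow2ᶻ s *_) (ℤ.*-identityˡ (resᶻ d L)) ⟩
      pow2ᶻ s * resᶻ d L ∎
      where
      open ≈-Reasoning (1 ℕ.+ s ℕ.+ m)
      N = 1 ℕ.+ s ℕ.+ m
      F : ℤ₂ → ℤ
      F y = resᶻ (f y) N
      u = ℕ→ℤ₂ x
      one = ℕ→ℤ₂ 1
      u′ = u +₂ (pow2 s *₂ one)
      lemma : ∀ a b → a + b - a ≡ b
      lemma = solve-∀
      args≈ : resᶻ (ℕ→ℤ₂ (x ℕ.+ 2 ^ s)) N ≈ resᶻ u′ N [mod2^ N ]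
      args≈ = begin
        resᶻ (ℕ→ℤ₂ (x ℕ.+ 2 ^ s)) N       ≈⟨ resᶻ-ℕ→ℤ₂ (x ℕ.+ 2 ^ s) N ⟩
        + (x ℕ.+ 2 ^ s)                   ≡⟨ trans (ℤ.pos-+ x (2 ^ s)) (cong (λ y → + x + y) (sym (ℤ.*-identityʳ (pow2ᶻ s)))) ⟩
        + x + pow2ᶻ s * + 1               ≈⟨ +-cong (resᶻ-ℕ→ℤ₂ x N) (*-congˡ (pow2ᶻ s) (resᶻ-ℕ→ℤ₂ 1 N)) ⟨
        resᶻ u N + pow2ᶻ s * resᶻ one N   ≈⟨ resᶻ-affine u s one N ⟨
        resᶻ u′ N                         ∎

    differentiable⇒StepDoubling : UnifDiffWith 1 1 f → ∀ t → 1 ≤ t → StepDoubling f t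
    differentiable⇒StepDoubling (∂ , congr) t 1≤t x
      with ∂ (ℕ→ℤ₂ x) | congr t 1≤t (ℕ→ℤ₂ x) (ℕ→ℤ₂ 1) | congr (suc t) (ℕ.m≤n⇒m≤1+n 1≤t) (ℕ→ℤ₂ x) (ℕ→ℤ₂ 1)
    ... | m , d | congr-t | congr-1+t = begin
      Δ2^ (suc t) (resSeq f (2 ℕ.+ t)) x     ≈⟨ Δ2^-level L≥2+t (suc t) x ⟨
      E₁                                     ≈⟨ -≈0⇒≈ defect≈0 ⟩
      + 2 * E₀                               ≈⟨ *-congˡ (+ 2) (Δ2^-level L≥2+t t x) ⟩
      + 2 * Δ2^ t (resSeq f (2 ℕ.+ t)) x     ∎
      where
      open ≈-Reasoning (2 ℕ.+ t)
      L = 2 ℕ.+ t ℕ.+ m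
      L≥2+t = ℕ.m≤m+n (2 ℕ.+ t) m
      D = resᶻ d L
      E₀ = Δ2^ t (resSeq f L) x
      E₁ = Δ2^ (suc t) (resSeq f L) x
      scaled : pow2ᶻ m * (E₁ - + 2 * E₀) ≈ pow2ᶻ m * 0ℤ [mod2^ L ]
      scaled = ≈-trans (≈-reflexive (lemma (pow2ᶻ m) E₁ E₀))
        (≈-trans (sub-cong (DiffCongr-at-ℕ {suc t} {x} {m} {d} congr-1+t ℕ.≤-refl)
                   (≈-scale {1} (DiffCongr-at-ℕ {t} {x} {m} {d} congr-t (ℕ.n≤1+n _))))
          (≈-reflexive (trans (cong (λ p → p * D - + 2 * (pow2ᶻ t * D)) (pow2ᶻ-+ 1 t)) (lemma′ (pow2ᶻ m) (pow2ᶻ t) D))))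
        where
        lemma : ∀ p a b → p * (a - + 2 * b) ≡ p * a - + 2 * (p * b)
        lemma = solve-∀
        lemma′ : ∀ p q d → + 2 * q * d - + 2 * (q * d) ≡ p * 0ℤ
        lemma′ = solve-∀
      defect≈0 : E₁ - + 2 * E₀ ≈ 0ℤ [mod2^ 2 ℕ.+ t ]
      defect≈0 = ≈-unscale {m} (subst (pow2ᶻ m * (E₁ - + 2 * E₀) ≈ pow2ᶻ m * 0ℤ [mod2^_]) (ℕ.+-comm (2 ℕ.+ t) m) scaled)

    module _ (doubling : ∀ t → 1 ≤ t → StepDoubling f t) where

      doubling-chain : ∀ t {K} → 2 ℕ.+ t ≤ K → ∀ X →
        Δ2^ (suc t) (resSeq f K) X ≈ pow2ᶻ t * Δ2^ 1 (resSeq f K) X [mod2^ 2 ℕ.+ t ]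
      doubling-chain zero    _       X = ≈-reflexive (sym (ℤ.*-identityˡ _))
      doubling-chain (suc t) {K} 3+t≤K X = begin
        Δ2^ (2 ℕ.+ t) g X               ≈⟨ StepDoubling-at (doubling (suc t) (s≤s z≤n)) 3+t≤K X ⟩
        + 2 * Δ2^ (suc t) g X           ≈⟨ ≈-scale {1} (doubling-chain t (ℕ.≤-trans (ℕ.n≤1+n _) 3+t≤K) X) ⟩
        + 2 * (pow2ᶻ t * Δ2^ 1 g X)     ≡⟨ ℤ.*-assoc (+ 2) (pow2ᶻ t) (Δ2^ 1 g X) ⟨
        + 2 * pow2ᶻ t * Δ2^ 1 g X       ≡⟨ cong (_* Δ2^ 1 g X) (pow2ᶻ-+ 1 t) ⟨
        pow2ᶻ (suc t) * Δ2^ 1 g X       ∎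
        where
        open ≈-Reasoning (3 ℕ.+ t)
        g = resSeq f K

      module _ (t X : ℕ) where
        private
          g = resSeq f (2 ℕ.+ t)
          lip = resSeq-Lipschitz (2 ℕ.+ t)
          E = Δ2^ 1 g X
          even-term : ∀ q → pow2ᶻ t * (+ (2 ℕ.* q) * E) ≈ 0ℤ [mod2^ 2 ℕ.+ t ]
          even-term q = subst (pow2ᶻ t * (+ (2 ℕ.* q) * E) ≈ 0ℤ [mod2^_]) (ℕ.+-comm t 2)
            (*-≈0 (pow2ᶻ≈0 t) (*-≈0 {1} (∣⇒+≈0 (ℕ.divides q (ℕ.*-comm 2 q))) (Δ2^-≈0 lip (s≤s z≤n) X)))

        doubling-expansion : ∀ H → g (X ℕ.+ 2 ^ suc t ℕ.* H) ≈ g X + pow2ᶻ t * (+ H * Δ2^ 1 g X) [mod2^ 2 ℕ.+ t ]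
        doubling-expansion H with even-or-odd H
        ... | q , inj₁ refl = begin
          g (X ℕ.+ 2 ^ suc t ℕ.* (2 ℕ.* q))       ≡⟨ cong (λ n → g (X ℕ.+ n)) (lemma (2 ^ t) q) ⟩
          g (X ℕ.+ 2 ^ (2 ℕ.+ t) ℕ.* q)           ≈⟨ lip ℕ.≤-refl X q ⟩
          g X                                     ≡⟨ ℤ.+-identityʳ (g X) ⟨
          g X + 0ℤ                                ≈⟨ +-congˡ (g X) (even-term q) ⟨
          g X + pow2ᶻ t * (+ (2 ℕ.* q) * E)       ∎
          where
          open ≈-Reasoning (2 ℕ.+ t)
          lemma : ∀ p q → 2 ℕ.* p ℕ.* (2 ℕ.* q) ≡ 2 ℕ.* (2 ℕ.* p) ℕ.* q
          lemma = ℕ.solve-∀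
        ... | q , inj₂ refl = begin
          g (X ℕ.+ 2 ^ suc t ℕ.* suc (2 ℕ.* q))            ≡⟨ cong g (lemma X (2 ^ t) q) ⟩
          g (X ℕ.+ 2 ^ suc t ℕ.+ 2 ^ (2 ℕ.+ t) ℕ.* q)       ≈⟨ lip ℕ.≤-refl (X ℕ.+ 2 ^ suc t) q ⟩
          g (X ℕ.+ 2 ^ suc t)                              ≡⟨ lemma′ (g (X ℕ.+ 2 ^ suc t)) (g X) ⟩
          g X + Δ2^ (suc t) g X                            ≈⟨ +-congˡ (g X) (doubling-chain t ℕ.≤-refl X) ⟩
          g X + pow2ᶻ t * E                                ≡⟨ ℤ.+-identityʳ _ ⟨
          g X + pow2ᶻ t * E + 0ℤ                           ≈⟨ +-congˡ (g X + pow2ᶻ t * E) (even-term q) ⟨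
          g X + pow2ᶻ t * E + pow2ᶻ t * (+ (2 ℕ.* q) * E)  ≡⟨ lemma″ (g X) (pow2ᶻ t) E (+ (2 ℕ.* q)) ⟩
          g X + pow2ᶻ t * ((1ℤ + + (2 ℕ.* q)) * E)         ≡⟨ cong (λ c → g X + pow2ᶻ t * (c * E)) (ℤ.pos-+ 1 (2 ℕ.* q)) ⟨
          g X + pow2ᶻ t * (+ suc (2 ℕ.* q) * E)            ∎
          where
          open ≈-Reasoning (2 ℕ.+ t)
          lemma : ∀ X p q → X ℕ.+ 2 ℕ.* p ℕ.* suc (2 ℕ.* q) ≡ X ℕ.+ 2 ℕ.* p ℕ.+ 2 ℕ.* (2 ℕ.* p) ℕ.* q
          lemma = ℕ.solve-∀
          lemma′ : ∀ a b → a ≡ b + (a - b)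
          lemma′ = solve-∀
          lemma″ : ∀ a p e c → a + p * e + p * (c * e) ≡ a + p * ((1ℤ + c) * e)
          lemma″ = solve-∀

      private
        ℕ→ℤ₂-≈ : ∀ {n K y} → + n ≈ resᶻ y K [mod2^ K ] → resSeq f K n ≈ resᶻ (f y) K [mod2^ K ]
        ℕ→ℤ₂-≈ {n} {K} n≈y = OneLipschitz-≈ (≈-trans (resᶻ-ℕ→ℤ₂ n K) n≈y)

      difference-quotient-congruence : ∀ t u h → let F = λ y → resᶻ (f y) (3 ℕ.+ t) in
        F (u +₂ (pow2 (suc t) *₂ h)) ≈ F u + pow2ᶻ t * (resᶻ h (3 ℕ.+ t) * (F (u +₂ pow2 1) - F u)) [mod2^ 2 ℕ.+ t ]
      difference-quotient-congruence t u h = begin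
        F (u +₂ (pow2 (suc t) *₂ h))
          ≈⟨ lower (f (u +₂ (pow2 (suc t) *₂ h))) ⟩
        Fₖ (u +₂ (pow2 (suc t) *₂ h))
          ≈⟨ ℕ→ℤ₂-≈ u′≈ ⟨
        g (X ℕ.+ 2 ^ suc t ℕ.* Hₖ)
          ≈⟨ doubling-expansion t X Hₖ ⟩
        g X + pow2ᶻ t * (+ Hₖ * (g (X ℕ.+ 2) - g X))
          ≈⟨ +-cong (ℕ→ℤ₂-≈ ≈-refl) (*-congˡ (pow2ᶻ t) (*-congˡ (+ Hₖ) (sub-cong (ℕ→ℤ₂-≈ u₂≈) (ℕ→ℤ₂-≈ ≈-refl)))) ⟩
        Fₖ u + pow2ᶻ t * (resᶻ h K * (Fₖ u₂ - Fₖ u))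
          ≈⟨ +-cong (lower (f u)) (*-congˡ (pow2ᶻ t) (*-cong (lower h) (sub-cong (lower (f u₂)) (lower (f u))))) ⟨
        F u + pow2ᶻ t * (resᶻ h (3 ℕ.+ t) * (F u₂ - F u))
          ∎
        where
        open ≈-Reasoning (2 ℕ.+ t)
        K = 2 ℕ.+ t
        F Fₖ : ℤ₂ → ℤ
        F y = resᶻ (f y) (3 ℕ.+ t)
        Fₖ y = resᶻ (f y) K
        g = resSeq f K
        lower : ∀ y → resᶻ y (3 ℕ.+ t) ≈ resᶻ y K [mod2^ K ]
        lower y = resᶻ-weaken y (ℕ.n≤1+n K)
        X = res u K
        Hₖ = res h K
        u₂ = u +₂ pow2 1
        u′≈ : + (X ℕ.+ 2 ^ suc t ℕ.* Hₖ) ≈ resᶻ (u +₂ (pow2 (suc t) *₂ h)) K [mod2^ K ]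
        u′≈ = ≈-trans (≈-reflexive (trans (ℤ.pos-+ X _) (cong (λ y → + X + y) (ℤ.pos-* (2 ^ suc t) Hₖ))))
                      (≈-sym (resᶻ-affine u (suc t) h K))
        u₂≈ : + (X ℕ.+ 2) ≈ resᶻ u₂ K [mod2^ K ]
        u₂≈ = ≈-trans (≈-reflexive (ℤ.pos-+ X 2)) (≈-sym (≈-trans (resᶻ-+₂ u (pow2 1) K) (+-congˡ (resᶻ u K) (resᶻ-ℕ→ℤ₂ 2 K))))

      StepDoubling⇒differentiable : UnifDiffWith 1 1 f
      StepDoubling⇒differentiable = ∂ , congr
        where
        ∂ : ℤ₂ → ℚ₂
        ∂ u = 1 , f (u +₂ pow2 1) +₂ (-₂ f u)
        congr : ∀ s → 1 ≤ s → ∀ u h → DiffCongr f 1 s u h (∂ u)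
        congr (suc t) _ u h = ≈⇒DiffCongr f {1} {suc t} {u} {h} {δ} {1}
          (subst (λ N → pow2ᶻ 1 * resᶻ (f u′) N ≈ pow2ᶻ 1 * resᶻ (f u) N + pow2ᶻ (suc t) * (resᶻ h N * resᶻ δ N) [mod2^ N ])
                 (cong (λ n → suc (suc n)) (ℕ.+-comm 1 t)) doubled)
          where
          open ≈-Reasoning (3 ℕ.+ t)
          u′ = u +₂ (pow2 (suc t) *₂ h)
          u₂ = u +₂ pow2 1
          δ = f u₂ +₂ (-₂ f u)
          F : ℤ₂ → ℤ
          F y = resᶻ (f y) (3 ℕ.+ t)
          H = resᶻ h (3 ℕ.+ t)
          δ≈ : resᶻ δ (3 ℕ.+ t) ≈ F u₂ - F u [mod2^ 3 ℕ.+ t ]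
          δ≈ = ≈-trans (resᶻ-+₂ (f u₂) (-₂ f u) _) (+-congˡ (F u₂) (resᶻ--₂ (f u) _))
          lemma : ∀ p F₀ H d → + 2 * (F₀ + p * (H * d)) ≡ + 2 * F₀ + + 2 * p * (H * d)
          lemma = solve-∀
          doubled : pow2ᶻ 1 * F u′ ≈ pow2ᶻ 1 * F u + pow2ᶻ (suc t) * (H * resᶻ δ (3 ℕ.+ t)) [mod2^ 3 ℕ.+ t ]
          doubled = begin
            pow2ᶻ 1 * F u′
              ≈⟨ ≈-scale {1} (difference-quotient-congruence t u h) ⟩
            pow2ᶻ 1 * (F u + pow2ᶻ t * (H * (F u₂ - F u)))
              ≡⟨ lemma (pow2ᶻ t) (F u) H (F u₂ - F u) ⟩
            pow2ᶻ 1 * F u + + 2 * pow2ᶻ t * (H * (F u₂ - F u))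
              ≡⟨ cong (λ p → pow2ᶻ 1 * F u + p * (H * (F u₂ - F u))) (pow2ᶻ-+ 1 t) ⟨
            pow2ᶻ 1 * F u + pow2ᶻ (suc t) * (H * (F u₂ - F u))
              ≈⟨ +-congˡ (pow2ᶻ 1 * F u) (*-congˡ (pow2ᶻ (suc t)) (*-congˡ H δ≈)) ⟨
            pow2ᶻ 1 * F u + pow2ᶻ (suc t) * (H * resᶻ δ (3 ℕ.+ t))
              ∎

open import Data.Nat using (_+_; _^_; _≤_; _<_; s≤s; z≤n)
open import Data.Product using (_,_)
open import Function.Bundles using (_⇔_; mk⇔)
open TwoAdic using (StepDoubling⇒mahler; differentiable⇒StepDoubling; StepDoubling⇒differentiable; mahler⇒StepDoubling)

theorem3p7 : (f : ℤ₂ → ℤ₂) → OneLipschitz f →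
    (HasNk 1 f 1 ⇔
    (∀ s → 2 ≤ s → ∀ n → 2 ^ s ≤ n → n < 2 ^ (s + 1) →
    mahler f n ≡[mod2^ (s + 1) ] 0ℤ₂))
theorem3p7 f lipF = mk⇔
  (λ (_ , differentiable , _) → StepDoubling⇒mahler lipF (differentiable⇒StepDoubling lipF differentiable))
  (λ aₙ≡0 → s≤s z≤n , StepDoubling⇒differentiable lipF (mahler⇒StepDoubling lipF aₙ≡0) , λ _ 1≤M _ → 1≤M)
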